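{- Let $u$ be a word of length $n$, and let $\mathcal{S}$ be a set containing at least $N$ pairwise disjoint (non-overlapping) factors of $u$, each of length at most $L$. Consider the following randomized procedure $\mathrm{Sampler}(u,N,L)$: set $\beta=n/N$, $T=\lceil\log_2 L\rceil$, $\mathcal{F}=\emptyset$; for each $t=0,\dots,T$, set $\ell_t=2^t$ and $r_t=\lceil 2\ln(3)\beta/\ell_t\rceil$, and for each $i=0,\dots,r_t$ independently pick $j$ uniformly at random in $\{0,\dots,n-1\}$ and add to $\mathcal{F}$ the factor $u[\max(j-\ell_t,0)\,..\,\min(j+\ell_t,n-1)]$; finally return $\mathcal{F}$. Then, with probability at least $2/3$, the returned set $\mathcal{F}$ contains a word having some word of $\mathcal{S}$ as a factor.
   Context: $u[a..b]$ denotes the factor of $u$ from position $a$ to position $b$ inclusive (positions indexed from $0$). Factors in $\mathcal{S}$ are understood as occurrences (position intervals) in $u$, pairwise disjoint. -}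

module Defs where

open import Data.Nat as ℕ using (ℕ; zero; suc; _+_; _*_; _∸_; _^_; _≤_; _<_; _⊓_)
open import Data.Nat.Logarithm using (⌈log₂_⌉)
open import Data.Fin using (Fin; toℕ)
open import Data.Integer using (+_)
open import Data.Rational as ℚ using (ℚ)
open import Data.List using (List; []; _∷_; _++_; take; drop; map; concat; replicate; upTo; length; zipWith)
open import Data.List.Relation.Unary.Any using (Any)
open import Data.List.Relation.Unary.All using (All)
open import Data.List.Relation.Unary.AllPairs using (AllPairs)
open import Data.List.Relation.Unary.Unique.Propositional using (Unique)
open import Data.Vec using (Vec; toList)
open import Data.Product using (Σ; ∃; ∃₂; _×_; _,_; proj₁; proj₂)
open import Data.Sum using (_⊎_)
open import Relation.Binary.PropositionalEquality using (_≡_)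

IsFactor : {A : Set} → List A → List A → Set
IsFactor w v = ∃₂ λ x y → v ≡ x ++ (w ++ y)

-- an occurrence (position interval) [a..b] in a word of length n
Interval : Set
Interval = ℕ × ℕ

ValidIn : ℕ → Interval → Set
ValidIn n (a , b) = a ≤ b × b < n

intervalLength : Interval → ℕ
intervalLength (a , b) = suc b ∸ a

Disjoint : Interval → Interval → Set
Disjoint (a , b) (c , d) = b < c ⊎ d < a

factorAt : {A : Set} {n : ℕ} → Vec A n → Interval → List A
factorAt u (a , b) = take (suc b ∸ a) (drop a (toList u))

-- ln 3 = 2 artanh(1/2) = Σ_{i ≥ 0} 1 / ((2i+1) 4^i); partial sums increase to ln 3

quarterPow : ℕ → ℚ
quarterPow zero    = ℚ.1ℚ
quarterPow (suc i) = (+ 1 ℚ./ 4) ℚ.* quarterPow i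

ln3Partial : ℕ → ℚ
ln3Partial zero    = ℚ.0ℚ
ln3Partial (suc m) = ln3Partial m ℚ.+ ((+ 1 ℚ./ suc (2 * m)) ℚ.* quarterPow m)

fromℕ : ℕ → ℚ
fromℕ k = + k ℚ./ 1

-- k = ⌈ 2 ln(3) β / ℓ ⌉ with β = n / N  (N, ℓ ≥ 1, n ≥ 1).
-- Since 2 ln(3) n / (N ℓ) > 0, this means: k ≥ 1,
--   k N ℓ ≥ 2 n ln 3      (i.e. ∀ m, 2 n · S_m ≤ k N ℓ, S_m the partial sums)
--   (k-1) N ℓ < 2 n ln 3  (i.e. ∃ m, (k-1) N ℓ < 2 n · S_m)
IsCeil2ln3β/ℓ : (n N ℓ k : ℕ) → Set
IsCeil2ln3β/ℓ n N ℓ k =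
  1 ≤ k
  × (∀ m → fromℕ (2 * n) ℚ.* ln3Partial m ℚ.≤ fromℕ (k * N * ℓ))
  × (∃ λ m → fromℕ ((k ∸ 1) * N * ℓ) ℚ.< fromℕ (2 * n) ℚ.* ln3Partial m)

samplerT : ℕ → ℕ
samplerT L = ⌈log₂ L ⌉

-- The list of the values ℓ_t used by the successive random draws:
-- for t = 0..T, the value 2^t repeated r_t + 1 times (i = 0..r_t).
drawLengths : (T : ℕ) → (r : ℕ → ℕ) → List ℕ
drawLengths T r = concat (map (λ t → replicate (suc (r t)) (2 ^ t)) (upTo (suc T)))

-- An outcome of the sampler's randomness: one j ∈ {0..n-1} per draw.
Outcome : (n T : ℕ) → (r : ℕ → ℕ) → Set
Outcome n T r = Vec (Fin n) (length (drawLengths T r))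

sampledFactor : {A : Set} {n : ℕ} → Vec A n → (j : Fin n) → (ℓ : ℕ) → List A
sampledFactor {n = n} u j ℓ = factorAt u (toℕ j ∸ ℓ , (toℕ j + ℓ) ⊓ (n ∸ 1))

samplerOutput : {A : Set} {n : ℕ} → Vec A n → (T : ℕ) → (r : ℕ → ℕ) →
                Outcome n T r → List (List A)
samplerOutput u T r ω = zipWith (sampledFactor u) (toList ω) (drawLengths T r)

Success : {A : Set} {n : ℕ} → Vec A n → List Interval → (T : ℕ) → (r : ℕ → ℕ) →
          Outcome n T r → Set
Success u S T r ω =
  Any (λ w → Any (λ s → IsFactor (factorAt u s) w) S) (samplerOutput u T r ω)

-- Pr[success] ≥ 2/3 under the uniform distribution on outcomes
-- (there are n ^ (number of draws) equally likely outcomes):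
-- there is a list of pairwise distinct successful outcomes whose number
-- is at least 2/3 of all outcomes.
ProbAtLeast2/3 : {A : Set} {n : ℕ} → Vec A n → List Interval → (T : ℕ) → (r : ℕ → ℕ) → Set
ProbAtLeast2/3 {n = n} u S T r =
  Σ (List (Outcome n T r)) λ good →
    Unique good × All (Success u S T r) good
    × 2 * n ^ length (drawLengths T r) ≤ 3 * length good

{-# OPTIONS --safe #-}
module Submission where

-- Call a position j a hit for a draw of radius ℓ if j lies in an interval s ∈ S with
-- |s| ≤ ℓ; the factor drawn around a hit contains u[s]. If h_ℓ positions are hits for radius ℓ, the
-- outcomes in which no draw hits number ∏ (n - h_ℓ) over the D draws, so it suffices to show
-- 3 ∏ (n - h_ℓ) ≤ n^D. As the intervals are disjoint, h_{2^t} is at least the total length of the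
-- intervals with ⌈log₂ |s|⌉ = t; since 2^t ≤ 2|s| and r_t ≥ 2 ln 3 β / 2^t, summing over the at least
-- N intervals gives Σ h_ℓ ≥ n ln 3. It remains to see that Σ xᵢ ≥ ln 3 forces ∏ (1 - xᵢ) ≤ 1/3 for
-- xᵢ ∈ [0, 1]. Since ln 3 is only given through the partial sums of 2 artanh ½, we pass to the
-- coordinate s = (1 - P)/(1 + P), in which ln (1 / P) = 2 artanh s: multiplying P by 1 - x raises the
-- M-th partial sum of 2 artanh s by at least (1 - 4^-M) x, so P = ∏ (1 - xᵢ) satisfies 3P - 1 ≤ 4^-M
-- for every M. As P is a multiple of 1/n^D, this forces 3P ≤ 1.

open import Defs

module ProductBound where

  open import Algebra.Bundles using (CommutativeRing)
  open import Data.Empty using (⊥-elim)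
  import Data.Integer as ℤ
  import Data.Integer.Tactic.RingSolver as ℤ
  open import Data.List using (List; []; _∷_; map; length)
  open import Data.List.Relation.Unary.All using (All; []; _∷_)
  open import Data.Nat as ℕ using (ℕ; zero; suc)
  import Data.Nat.Properties as ℕ
  open import Data.Nat.Coprimality using (1-coprimeTo) renaming (sym to coprime-sym)
  open import Data.Nat.ListAction using (sum; product)
  open import Data.Product using (_×_; _,_; proj₁; proj₂)
  open import Data.Rational as ℚ
    using (ℚ; mkℚ; _+_; _*_; _-_; -_; _≤_; _<_; 0ℚ; 1ℚ; ½; toℚᵘ; _/_; 1/_)
  import Data.Rational.Properties as ℚ
  open import Data.Rational.Solver using (module +-*-Solver)
  import Data.Rational.Unnormalised as ℚᵘ
  import Data.Rational.Unnormalised.Properties as ℚᵘ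
  open import Relation.Binary.PropositionalEquality
  open import Relation.Nullary using (yes; no)
  open import Algebra.Properties.CommutativeSemiring.Exp
    (CommutativeRing.commutativeSemiring ℚ.+-*-commutativeRing) using (_^_; ^-distrib-*)
  open +-*-Solver using (solve; _:=_; _:+_; _:*_; _:-_; con)

  2ℚ 3ℚ : ℚ
  2ℚ = fromℕ 2
  3ℚ = fromℕ 3

  fromℕ≡mkℚ : ∀ k → fromℕ k ≡ mkℚ (ℤ.+ k) 0 (coprime-sym (1-coprimeTo k))
  fromℕ≡mkℚ k = ℚ.normalize-coprime (coprime-sym (1-coprimeTo k))

  fromℕ-suc : ∀ k → fromℕ (suc k) ≡ 1ℚ + fromℕ k
  fromℕ-suc k = ℚ.toℚᵘ-injective (ℚᵘ.≃-trans unnormalised (ℚᵘ.≃-sym (ℚ.toℚᵘ-homo-+ 1ℚ (fromℕ k))))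
    where
    identity : ∀ i → (ℤ.+ 1 ℤ.+ i) ℤ.* ℤ.+ 1 ≡ (ℤ.+ 1 ℤ.* ℤ.+ 1 ℤ.+ i ℤ.* ℤ.+ 1) ℤ.* ℤ.+ 1
    identity = ℤ.solve-∀
    unnormalised : toℚᵘ (fromℕ (suc k)) ℚᵘ.≃ toℚᵘ 1ℚ ℚᵘ.+ toℚᵘ (fromℕ k)
    unnormalised rewrite fromℕ≡mkℚ (suc k) | fromℕ≡mkℚ k = ℚᵘ.*≡* (identity (ℤ.+ k))

  fromℕ-+ : ∀ m n → fromℕ (m ℕ.+ n) ≡ fromℕ m + fromℕ n
  fromℕ-+ zero    n = sym (ℚ.+-identityˡ (fromℕ n))
  fromℕ-+ (suc m) n = begin
    fromℕ (suc (m ℕ.+ n))     ≡⟨ fromℕ-suc (m ℕ.+ n) ⟩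
    1ℚ + fromℕ (m ℕ.+ n)      ≡⟨ cong (1ℚ +_) (fromℕ-+ m n) ⟩
    1ℚ + (fromℕ m + fromℕ n)  ≡⟨ ℚ.+-assoc 1ℚ (fromℕ m) (fromℕ n) ⟨
    1ℚ + fromℕ m + fromℕ n    ≡⟨ cong (_+ fromℕ n) (fromℕ-suc m) ⟨
    fromℕ (suc m) + fromℕ n   ∎
    where open ≡-Reasoning

  fromℕ-* : ∀ m n → fromℕ (m ℕ.* n) ≡ fromℕ m * fromℕ n
  fromℕ-* zero    n = sym (ℚ.*-zeroˡ (fromℕ n))
  fromℕ-* (suc m) n = begin
    fromℕ (n ℕ.+ m ℕ.* n)        ≡⟨ fromℕ-+ n (m ℕ.* n) ⟩
    fromℕ n + fromℕ (m ℕ.* n)    ≡⟨ cong (fromℕ n +_) (fromℕ-* m n) ⟩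
    fromℕ n + fromℕ m * fromℕ n  ≡⟨ distrib (fromℕ m) (fromℕ n) ⟩
    (1ℚ + fromℕ m) * fromℕ n     ≡⟨ cong (_* fromℕ n) (fromℕ-suc m) ⟨
    fromℕ (suc m) * fromℕ n      ∎
    where
    open ≡-Reasoning
    distrib : ∀ a b → b + a * b ≡ (1ℚ + a) * b
    distrib = solve 2 (λ a b → b :+ a :* b := (con 1ℚ :+ a) :* b) refl

  fromℕ-∸ : ∀ {m n} → n ℕ.≤ m → fromℕ (m ℕ.∸ n) ≡ fromℕ m - fromℕ n
  fromℕ-∸ {m} {n} n≤m = begin
    fromℕ (m ℕ.∸ n)                      ≡⟨ cancel (fromℕ n) (fromℕ (m ℕ.∸ n)) ⟨
    fromℕ n + fromℕ (m ℕ.∸ n) - fromℕ n  ≡⟨ cong (_- fromℕ n) (fromℕ-+ n (m ℕ.∸ n)) ⟨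
    fromℕ (n ℕ.+ (m ℕ.∸ n)) - fromℕ n    ≡⟨ cong (λ k → fromℕ k - fromℕ n) (ℕ.m+[n∸m]≡n n≤m) ⟩
    fromℕ m - fromℕ n                    ∎
    where
    open ≡-Reasoning
    cancel : ∀ a b → a + b - a ≡ b
    cancel = solve 2 (λ a b → a :+ b :- a := b) refl

  fromℕ-^ : ∀ m k → fromℕ (m ℕ.^ k) ≡ fromℕ m ^ k
  fromℕ-^ m zero    = refl
  fromℕ-^ m (suc k) = trans (fromℕ-* m (m ℕ.^ k)) (cong (fromℕ m *_) (fromℕ-^ m k))

  0≤1 : 0ℚ ≤ 1ℚ
  0≤1 = ℚ.nonNegative⁻¹ 1ℚ

  0≤½ : 0ℚ ≤ ½
  0≤½ = ℚ.nonNegative⁻¹ ½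

  0≤2 : 0ℚ ≤ 2ℚ
  0≤2 = ℚ.nonNegative⁻¹ 2ℚ

  0≤fromℕ : ∀ k → 0ℚ ≤ fromℕ k
  0≤fromℕ k = ℚ.nonNegative⁻¹ (fromℕ k) {{ℚ.normalize-nonNeg k 1}}

  0<fromℕ : ∀ k → 0ℚ < fromℕ (suc k)
  0<fromℕ k = ℚ.positive⁻¹ (fromℕ (suc k)) {{ℚ.normalize-pos (suc k) 1}}

  ≤-by-gap : ∀ {p q r} → q - p ≡ r → 0ℚ ≤ r → p ≤ q
  ≤-by-gap {p} {q} {r} q-p≡r 0≤r = begin
    p            ≡⟨ ℚ.+-identityʳ p ⟨
    p + 0ℚ       ≤⟨ ℚ.+-monoʳ-≤ p 0≤r ⟩
    p + r        ≡⟨ cong (p +_) q-p≡r ⟨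
    p + (q - p)  ≡⟨ cancel p q ⟩
    q            ∎
    where
    open ℚ.≤-Reasoning
    cancel : ∀ a b → a + (b - a) ≡ b
    cancel = solve 2 (λ a b → a :+ (b :- a) := b) refl

  p≤q⇒0≤q-p : ∀ {p q} → p ≤ q → 0ℚ ≤ q - p
  p≤q⇒0≤q-p {p} {q} p≤q = begin
    0ℚ     ≡⟨ ℚ.+-inverseʳ p ⟨
    p - p  ≤⟨ ℚ.+-monoˡ-≤ (- p) p≤q ⟩
    q - p  ∎
    where open ℚ.≤-Reasoning

  fromℕ-mono-≤ : ∀ {m n} → m ℕ.≤ n → fromℕ m ≤ fromℕ n
  fromℕ-mono-≤ {m} {n} m≤n = ≤-by-gap (sym (fromℕ-∸ m≤n)) (0≤fromℕ (n ℕ.∸ m))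

  *-nonNeg : ∀ {p q} → 0ℚ ≤ p → 0ℚ ≤ q → 0ℚ ≤ p * q
  *-nonNeg {p} {q} 0≤p 0≤q = ℚ.nonNegative⁻¹ (p * q)
    {{ℚ.nonNeg*nonNeg⇒nonNeg p {{ℚ.nonNegative 0≤p}} q {{ℚ.nonNegative 0≤q}}}}

  *-pos : ∀ {p q} → 0ℚ < p → 0ℚ < q → 0ℚ < p * q
  *-pos {p} {q} 0<p 0<q = ℚ.positive⁻¹ (p * q)
    {{ℚ.pos*pos⇒pos p {{ℚ.positive 0<p}} q {{ℚ.positive 0<q}}}}

  *-monoˡ-≤-nonNeg′ : ∀ {r p q} → 0ℚ ≤ r → p ≤ q → r * p ≤ r * q
  *-monoˡ-≤-nonNeg′ {r} 0≤r = ℚ.*-monoˡ-≤-nonNeg r {{ℚ.nonNegative 0≤r}}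

  *-monoʳ-≤-nonNeg′ : ∀ {r p q} → 0ℚ ≤ r → p ≤ q → p * r ≤ q * r
  *-monoʳ-≤-nonNeg′ {r} 0≤r = ℚ.*-monoʳ-≤-nonNeg r {{ℚ.nonNegative 0≤r}}

  *-cancelˡ-≤-pos′ : ∀ {r p q} → 0ℚ < r → r * p ≤ r * q → p ≤ q
  *-cancelˡ-≤-pos′ {r} 0<r = ℚ.*-cancelˡ-≤-pos r {{ℚ.positive 0<r}}

  ≤-by-scaled-gap : ∀ {c p q r} → 0ℚ < c → c * q - c * p ≡ r → 0ℚ ≤ r → p ≤ q
  ≤-by-scaled-gap 0<c gap 0≤r = *-cancelˡ-≤-pos′ 0<c (≤-by-gap gap 0≤r)

  -- A total reciprocal with junk value inv 0ℚ = 0ℚ, so that no NonZero instance is needed.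
  inv : ℚ → ℚ
  inv q with q ℚ.≟ 0ℚ
  ... | yes _   = 0ℚ
  ... | no q≢0 = 1/_ q {{ℚ.≢-nonZero q≢0}}

  *-inv : ∀ {q} → 0ℚ < q → q * inv q ≡ 1ℚ
  *-inv {q} 0<q with q ℚ.≟ 0ℚ
  ... | yes q≡0 = ⊥-elim (ℚ.<-irrefl (sym q≡0) 0<q)
  ... | no q≢0 = ℚ.*-inverseʳ q {{ℚ.≢-nonZero q≢0}}

  0≤inv : ∀ {q} → 0ℚ < q → 0ℚ ≤ inv q
  0≤inv {q} 0<q with q ℚ.≟ 0ℚ
  ... | yes _   = ℚ.≤-refl
  ... | no q≢0 = ℚ.<⇒≤ (ℚ.positive⁻¹ _ {{ℚ.1/pos⇒pos q {{ℚ.positive 0<q}}}})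

  ^-nonNeg : ∀ {x} → 0ℚ ≤ x → ∀ k → 0ℚ ≤ x ^ k
  ^-nonNeg 0≤x zero    = 0≤1
  ^-nonNeg 0≤x (suc k) = *-nonNeg 0≤x (^-nonNeg 0≤x k)

  ^-pos : ∀ {x} → 0ℚ < x → ∀ k → 0ℚ < x ^ k
  ^-pos 0<x zero    = ℚ.positive⁻¹ 1ℚ
  ^-pos 0<x (suc k) = *-pos 0<x (^-pos 0<x k)

  ^-mono-≤ : ∀ {x y} → 0ℚ ≤ x → x ≤ y → ∀ k → x ^ k ≤ y ^ k
  ^-mono-≤ 0≤x x≤y zero    = ℚ.≤-refl
  ^-mono-≤ {x} {y} 0≤x x≤y (suc k) = begin
    x * x ^ k  ≤⟨ *-monoˡ-≤-nonNeg′ 0≤x (^-mono-≤ 0≤x x≤y k) ⟩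
    x * y ^ k  ≤⟨ *-monoʳ-≤-nonNeg′ (^-nonNeg (ℚ.≤-trans 0≤x x≤y) k) x≤y ⟩
    y * y ^ k  ∎
    where open ℚ.≤-Reasoning

  1^k≡1 : ∀ k → 1ℚ ^ k ≡ 1ℚ
  1^k≡1 zero    = refl
  1^k≡1 (suc k) = trans (ℚ.*-identityˡ (1ℚ ^ k)) (1^k≡1 k)

  ^-double : ∀ x i → x ^ (2 ℕ.* i) ≡ (x * x) ^ i
  ^-double x zero    = refl
  ^-double x (suc i) = begin
    x ^ (2 ℕ.* suc i)        ≡⟨ cong (x ^_) (ℕ.*-suc 2 i) ⟩
    x * (x * x ^ (2 ℕ.* i))  ≡⟨ ℚ.*-assoc x x _ ⟨
    x * x * x ^ (2 ℕ.* i)    ≡⟨ cong (x * x *_) (^-double x i) ⟩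
    (x * x) ^ suc i          ∎
    where open ≡-Reasoning

  ^-mean-value : ∀ {a b} → 0ℚ ≤ b → b ≤ a → ∀ k →
                 fromℕ (suc k) * b ^ k * (a - b) ≤ a ^ suc k - b ^ suc k
  ^-mean-value {a} {b} 0≤b b≤a zero = ℚ.≤-reflexive (base a b)
    where
    base : ∀ a b → 1ℚ * 1ℚ * (a - b) ≡ a * 1ℚ - b * 1ℚ
    base = solve 2 (λ a b → con 1ℚ :* con 1ℚ :* (a :- b) := a :* con 1ℚ :- b :* con 1ℚ) refl
  ^-mean-value {a} {b} 0≤b b≤a (suc k) = begin
    fromℕ (2 ℕ.+ k) * b ^ suc k * (a - b)    ≡⟨ cong (λ c → c * b ^ suc k * (a - b)) (fromℕ-suc (suc k)) ⟩
    (1ℚ + K) * (b * b ^ k) * (a - b)         ≡⟨ split K b (b ^ k) (a - b) ⟩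
    b * (K * b ^ k * (a - b)) + b * b ^ k * (a - b)
      ≤⟨ ℚ.+-monoˡ-≤ _ (*-monoʳ-≤-nonNeg′ 0≤term b≤a) ⟩
    a * (K * b ^ k * (a - b)) + b * b ^ k * (a - b)
      ≤⟨ ℚ.+-monoˡ-≤ _ (*-monoˡ-≤-nonNeg′ (ℚ.≤-trans 0≤b b≤a) (^-mean-value 0≤b b≤a k)) ⟩
    a * (a * a ^ k - b * b ^ k) + b * b ^ k * (a - b)
      ≡⟨ telescope a b (a ^ k) (b ^ k) ⟩
    a ^ suc (suc k) - b ^ suc (suc k)        ∎
    where
    open ℚ.≤-Reasoning
    K = fromℕ (suc k)
    0≤term : 0ℚ ≤ K * b ^ k * (a - b)
    0≤term = *-nonNeg (*-nonNeg (0≤fromℕ (suc k)) (^-nonNeg 0≤b k)) (p≤q⇒0≤q-p b≤a)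
    split : ∀ K b B d → (1ℚ + K) * (b * B) * d ≡ b * (K * B * d) + b * B * d
    split = solve 4 (λ K b B d →
      (con 1ℚ :+ K) :* (b :* B) :* d := b :* (K :* B :* d) :+ b :* B :* d) refl
    telescope : ∀ a b A B → a * (a * A - b * B) + b * B * (a - b) ≡ a * (a * A) - b * (b * B)
    telescope = solve 4 (λ a b A B →
      a :* (a :* A :- b :* B) :+ b :* B :* (a :- b) := a :* (a :* A) :- b :* (b :* B)) refl

  quarterPow≡[½*½]^ : ∀ m → quarterPow m ≡ (½ * ½) ^ m
  quarterPow≡[½*½]^ zero    = refl
  quarterPow≡[½*½]^ (suc m) = cong ((½ * ½) *_) (quarterPow≡[½*½]^ m)

  0≤quarterPow : ∀ m → 0ℚ ≤ quarterPow m
  0≤quarterPow m = subst (0ℚ ≤_) (sym (quarterPow≡[½*½]^ m)) (^-nonNeg (*-nonNeg 0≤½ 0≤½) m)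

  0<quarterPow : ∀ m → 0ℚ < quarterPow m
  0<quarterPow m = subst (0ℚ <_) (sym (quarterPow≡[½*½]^ m)) (^-pos (ℚ.positive⁻¹ (½ * ½)) m)

  quarterPow≤1 : ∀ m → quarterPow m ≤ 1ℚ
  quarterPow≤1 m = begin
    quarterPow m  ≡⟨ quarterPow≡[½*½]^ m ⟩
    (½ * ½) ^ m   ≤⟨ ^-mono-≤ (*-nonNeg 0≤½ 0≤½) (ℚ.≤ᵇ⇒≤ _) m ⟩
    1ℚ ^ m        ≡⟨ 1^k≡1 m ⟩
    1ℚ            ∎
    where open ℚ.≤-Reasoning

  [1+k]*quarterPow≤1 : ∀ k → fromℕ (suc k) * quarterPow k ≤ 1ℚ
  [1+k]*quarterPow≤1 zero    = ℚ.≤-refl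
  [1+k]*quarterPow≤1 (suc k) = begin
    fromℕ (2 ℕ.+ k) * (¼ * quarterPow k)   ≡⟨ ℚ.*-assoc (fromℕ (2 ℕ.+ k)) ¼ (quarterPow k) ⟨
    fromℕ (2 ℕ.+ k) * ¼ * quarterPow k     ≤⟨ *-monoʳ-≤-nonNeg′ (0≤quarterPow k) shrink ⟩
    fromℕ (suc k) * quarterPow k           ≤⟨ [1+k]*quarterPow≤1 k ⟩
    1ℚ                                     ∎
    where
    open ℚ.≤-Reasoning
    ¼ = ℤ.+ 1 / 4
    gap : ∀ K → (1ℚ + K) - (1ℚ + (1ℚ + K)) * ¼ ≡ ½ + 3ℚ * ¼ * K
    gap = solve 1 (λ K →
      (con 1ℚ :+ K) :- (con 1ℚ :+ (con 1ℚ :+ K)) :* con ¼ := con ½ :+ con 3ℚ :* con ¼ :* K) refl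
    shrink : fromℕ (2 ℕ.+ k) * ¼ ≤ fromℕ (suc k)
    shrink rewrite fromℕ-suc (suc k) | fromℕ-suc k =
      ≤-by-gap (gap (fromℕ k)) (ℚ.+-mono-≤ 0≤½ (*-nonNeg (ℚ.nonNegative⁻¹ (3ℚ * ¼)) (0≤fromℕ k)))

  K*quarterPow<1 : ∀ K → fromℕ K * quarterPow K < 1ℚ
  K*quarterPow<1 K = begin-strict
    fromℕ K * quarterPow K                 ≡⟨ ℚ.+-identityʳ _ ⟨
    fromℕ K * quarterPow K + 0ℚ            <⟨ ℚ.+-monoʳ-< (fromℕ K * quarterPow K) (0<quarterPow K) ⟩
    fromℕ K * quarterPow K + quarterPow K  ≡⟨ absorb (fromℕ K) (quarterPow K) ⟩
    (1ℚ + fromℕ K) * quarterPow K          ≡⟨ cong (_* quarterPow K) (fromℕ-suc K) ⟨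
    fromℕ (suc K) * quarterPow K           ≤⟨ [1+k]*quarterPow≤1 K ⟩
    1ℚ                                     ∎
    where
    open ℚ.≤-Reasoning
    absorb : ∀ k q → k * q + q ≡ (1ℚ + k) * q
    absorb = solve 2 (λ k q → k :* q :+ q := (con 1ℚ :+ k) :* q) refl

  -- The artanh series

  recipOdd : ℕ → ℚ
  recipOdd i = ℤ.+ 1 / suc (2 ℕ.* i)

  recipOdd-inverse : ∀ i → recipOdd i * fromℕ (suc (2 ℕ.* i)) ≡ 1ℚ
  recipOdd-inverse i
    rewrite fromℕ≡mkℚ (suc (2 ℕ.* i))
          | ℚ.normalize-coprime {1} {2 ℕ.* i} (1-coprimeTo (suc (2 ℕ.* i)))
    = ℚ.*-inverseˡ (mkℚ (ℤ.+ suc (2 ℕ.* i)) 0 (coprime-sym (1-coprimeTo (suc (2 ℕ.* i)))))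

  0≤recipOdd : ∀ i → 0ℚ ≤ recipOdd i
  0≤recipOdd i = ℚ.nonNegative⁻¹ (recipOdd i) {{ℚ.normalize-nonNeg 1 (suc (2 ℕ.* i))}}

  recipOdd≤1 : ∀ i → recipOdd i ≤ 1ℚ
  recipOdd≤1 i = begin
    recipOdd i                          ≡⟨ ℚ.*-identityʳ (recipOdd i) ⟨
    recipOdd i * 1ℚ
      ≤⟨ *-monoˡ-≤-nonNeg′ (0≤recipOdd i) (fromℕ-mono-≤ {1} {suc (2 ℕ.* i)} (ℕ.s≤s ℕ.z≤n)) ⟩
    recipOdd i * fromℕ (suc (2 ℕ.* i))  ≡⟨ recipOdd-inverse i ⟩
    1ℚ                                  ∎
    where open ℚ.≤-Reasoning

  -- The partial sums Σ_{i<M} 2 s^(2i+1) / (2i+1) of 2 artanh s = ln ((1 + s) / (1 - s)).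
  logRatio : ℕ → ℚ → ℚ
  logRatio zero    s = 0ℚ
  logRatio (suc M) s = logRatio M s + recipOdd M * (2ℚ * (s * (s * s) ^ M))

  geometric : ℕ → ℚ → ℚ
  geometric zero    s = 0ℚ
  geometric (suc M) s = geometric M s + (s * s) ^ M

  logRatio-½ : ∀ M → logRatio M ½ ≡ ln3Partial M
  logRatio-½ zero    = refl
  logRatio-½ (suc M) = cong₂ (λ a b → a + recipOdd M * b) (logRatio-½ M)
                             (trans (double-half ((½ * ½) ^ M)) (sym (quarterPow≡[½*½]^ M)))
    where
    double-half : ∀ y → 2ℚ * (½ * y) ≡ y
    double-half = solve 1 (λ y → con 2ℚ :* (con ½ :* y) := y) refl

  logRatio-0 : ∀ M → logRatio M 0ℚ ≡ 0ℚ
  logRatio-0 zero    = refl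
  logRatio-0 (suc M) rewrite logRatio-0 M = vanish (recipOdd M) ((0ℚ * 0ℚ) ^ M)
    where
    vanish : ∀ c e → 0ℚ + c * (2ℚ * (0ℚ * e)) ≡ 0ℚ
    vanish = solve 2 (λ c e → con 0ℚ :+ c :* (con 2ℚ :* (con 0ℚ :* e)) := con 0ℚ) refl

  geometric-closed : ∀ s M → (1ℚ - s * s) * geometric M s ≡ 1ℚ - (s * s) ^ M
  geometric-closed s zero    = vanish s
    where
    vanish : ∀ s → (1ℚ - s * s) * 0ℚ ≡ 1ℚ - 1ℚ
    vanish = solve 1 (λ s → (con 1ℚ :- s :* s) :* con 0ℚ := con 1ℚ :- con 1ℚ) refl
  geometric-closed s (suc M) = begin
    (1ℚ - s * s) * (geometric M s + e)              ≡⟨ expand s (geometric M s) e ⟩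
    (1ℚ - s * s) * geometric M s + e - s * s * e    ≡⟨ cong (λ g → g + e - s * s * e) (geometric-closed s M) ⟩
    1ℚ - e + e - s * s * e                          ≡⟨ collapse e (s * s * e) ⟩
    1ℚ - (s * s) ^ suc M                            ∎
    where
    open ≡-Reasoning
    e = (s * s) ^ M
    expand : ∀ s g e → (1ℚ - s * s) * (g + e) ≡ (1ℚ - s * s) * g + e - s * s * e
    expand = solve 3 (λ s g e →
      (con 1ℚ :- s :* s) :* (g :+ e) := (con 1ℚ :- s :* s) :* g :+ e :- s :* s :* e) refl
    collapse : ∀ e f → 1ℚ - e + e - f ≡ 1ℚ - f
    collapse = solve 2 (λ e f → con 1ℚ :- e :+ e :- f := con 1ℚ :- f) refl

  geometric-nonNeg : ∀ {s} → 0ℚ ≤ s → ∀ M → 0ℚ ≤ geometric M s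
  geometric-nonNeg 0≤s zero    = ℚ.≤-refl
  geometric-nonNeg 0≤s (suc M) = ℚ.+-mono-≤ (geometric-nonNeg 0≤s M) (^-nonNeg (*-nonNeg 0≤s 0≤s) M)

  1≤geometric : ∀ {s} → 0ℚ ≤ s → ∀ M → 1ℚ ≤ geometric (suc M) s
  1≤geometric 0≤s zero    = ℚ.≤-reflexive (sym (ℚ.+-identityˡ 1ℚ))
  1≤geometric {s} 0≤s (suc M) = begin
    1ℚ                                           ≡⟨ ℚ.+-identityʳ 1ℚ ⟨
    1ℚ + 0ℚ
      ≤⟨ ℚ.+-mono-≤ (1≤geometric 0≤s M) (^-nonNeg (*-nonNeg 0≤s 0≤s) (suc M)) ⟩
    geometric (suc M) s + (s * s) ^ suc M        ∎
    where open ℚ.≤-Reasoning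

  odd-mean-value : ∀ {a b} → 0ℚ ≤ b → b ≤ a → ∀ i →
    (b * b) ^ i * (a - b) ≤ recipOdd i * (a * (a * a) ^ i - b * (b * b) ^ i)
  odd-mean-value {a} {b} 0≤b b≤a i = begin
    (b * b) ^ i * (a - b)                             ≡⟨ ℚ.*-identityˡ _ ⟨
    1ℚ * ((b * b) ^ i * (a - b))                      ≡⟨ cong (_* ((b * b) ^ i * (a - b))) (recipOdd-inverse i) ⟨
    recipOdd i * n * ((b * b) ^ i * (a - b))          ≡⟨ regroup (recipOdd i) n ((b * b) ^ i) (a - b) ⟩
    recipOdd i * (n * (b * b) ^ i * (a - b))          ≤⟨ *-monoˡ-≤-nonNeg′ (0≤recipOdd i) mean-value ⟩
    recipOdd i * (a * (a * a) ^ i - b * (b * b) ^ i)  ∎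
    where
    open ℚ.≤-Reasoning
    n = fromℕ (suc (2 ℕ.* i))
    mean-value : n * (b * b) ^ i * (a - b) ≤ a * (a * a) ^ i - b * (b * b) ^ i
    mean-value = subst₂ (λ B A → n * B * (a - b) ≤ a * A - b * B)
                        (^-double b i) (^-double a i) (^-mean-value 0≤b b≤a (2 ℕ.* i))
    regroup : ∀ c n B d → c * n * (B * d) ≡ c * (n * B * d)
    regroup = solve 4 (λ c n B d → c :* n :* (B :* d) := c :* (n :* B :* d)) refl

  logRatio-increment : ∀ {a b} → 0ℚ ≤ b → b ≤ a → ∀ M →
    2ℚ * (a - b) * geometric M b ≤ logRatio M a - logRatio M b
  logRatio-increment {a} {b} 0≤b b≤a zero = ℚ.≤-reflexive (vanish (a - b))
    where
    vanish : ∀ d → 2ℚ * d * 0ℚ ≡ 0ℚ - 0ℚ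
    vanish = solve 1 (λ d → con 2ℚ :* d :* con 0ℚ := con 0ℚ :- con 0ℚ) refl
  logRatio-increment {a} {b} 0≤b b≤a (suc M) = begin
    2ℚ * (a - b) * (geometric M b + e)                ≡⟨ expand (a - b) (geometric M b) e ⟩
    2ℚ * (a - b) * geometric M b + 2ℚ * (e * (a - b))
      ≤⟨ ℚ.+-mono-≤ (logRatio-increment 0≤b b≤a M) (*-monoˡ-≤-nonNeg′ 0≤2 (odd-mean-value 0≤b b≤a M)) ⟩
    (logRatio M a - logRatio M b) + 2ℚ * (recipOdd M * (oa - ob))
      ≡⟨ collect (logRatio M a) (logRatio M b) (recipOdd M) oa ob ⟩
    logRatio (suc M) a - logRatio (suc M) b           ∎
    where
    open ℚ.≤-Reasoning
    e = (b * b) ^ M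
    oa = a * (a * a) ^ M
    ob = b * (b * b) ^ M
    expand : ∀ d g e → 2ℚ * d * (g + e) ≡ 2ℚ * d * g + 2ℚ * (e * d)
    expand = solve 3 (λ d g e → con 2ℚ :* d :* (g :+ e) := con 2ℚ :* d :* g :+ con 2ℚ :* (e :* d)) refl
    collect : ∀ x y c p q → (x - y) + 2ℚ * (c * (p - q)) ≡ (x + c * (2ℚ * p)) - (y + c * (2ℚ * q))
    collect = solve 5 (λ x y c p q →
      (x :- y) :+ con 2ℚ :* (c :* (p :- q)) := (x :+ c :* (con 2ℚ :* p)) :- (y :+ c :* (con 2ℚ :* q))) refl

  0≤ln3Partial : ∀ m → 0ℚ ≤ ln3Partial m
  0≤ln3Partial zero    = ℚ.≤-refl
  0≤ln3Partial (suc m) = ℚ.+-mono-≤ (0≤ln3Partial m) (*-nonNeg (0≤recipOdd m) (0≤quarterPow m))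

  ln3Partial≤2 : ∀ m → ln3Partial m ≤ 2ℚ
  ln3Partial≤2 m = ℚ.≤-trans (bound m) (≤-by-gap (drop (quarterPow m)) (*-nonNeg 0≤2 (0≤quarterPow m)))
    where
    drop : ∀ q → 2ℚ - (2ℚ - 2ℚ * q) ≡ 2ℚ * q
    drop = solve 1 (λ q → con 2ℚ :- (con 2ℚ :- con 2ℚ :* q) := con 2ℚ :* q) refl
    gap : ∀ q → 2ℚ - 2ℚ * ((ℤ.+ 1 / 4) * q) - (2ℚ - 2ℚ * q + q) ≡ q * ½
    gap = solve 1 (λ q →
      con 2ℚ :- con 2ℚ :* ((con (ℤ.+ 1 / 4)) :* q) :- (con 2ℚ :- con 2ℚ :* q :+ q) := q :* con ½) refl
    bound : ∀ m → ln3Partial m ≤ 2ℚ - 2ℚ * quarterPow m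
    bound zero    = ℚ.≤-refl
    bound (suc m) = begin
      ln3Partial m + recipOdd m * quarterPow m  ≤⟨ ℚ.+-mono-≤ (bound m) term≤ ⟩
      2ℚ - 2ℚ * quarterPow m + quarterPow m     ≤⟨ ≤-by-gap (gap (quarterPow m)) (*-nonNeg (0≤quarterPow m) 0≤½) ⟩
      2ℚ - 2ℚ * quarterPow (suc m)              ∎
      where
      open ℚ.≤-Reasoning
      term≤ : recipOdd m * quarterPow m ≤ quarterPow m
      term≤ = ℚ.≤-trans (*-monoʳ-≤-nonNeg′ (0≤quarterPow m) (recipOdd≤1 m)) (ℚ.≤-reflexive (ℚ.*-identityˡ _))

  -- Cayley coordinates

  0<1+ : ∀ {P} → 0ℚ ≤ P → 0ℚ < 1ℚ + P
  0<1+ {P} 0≤P = begin-strict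
    0ℚ       <⟨ ℚ.positive⁻¹ 1ℚ ⟩
    1ℚ       ≡⟨ ℚ.+-identityʳ 1ℚ ⟨
    1ℚ + 0ℚ  ≤⟨ ℚ.+-monoʳ-≤ 1ℚ 0≤P ⟩
    1ℚ + P   ∎
    where open ℚ.≤-Reasoning

  -- s = (1 - P) / (1 + P) is the inverse of P = (1 - s) / (1 + s), so logRatio M (cayley P)
  -- approximates ln (1 / P).
  cayley : ℚ → ℚ
  cayley P = (1ℚ - P) * inv (1ℚ + P)

  cayley-spec : ∀ {P} → 0ℚ ≤ P → cayley P * (1ℚ + P) ≡ 1ℚ - P
  cayley-spec {P} 0≤P = begin
    (1ℚ - P) * inv (1ℚ + P) * (1ℚ + P)    ≡⟨ regroup (1ℚ - P) (inv (1ℚ + P)) (1ℚ + P) ⟩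
    (1ℚ - P) * ((1ℚ + P) * inv (1ℚ + P))  ≡⟨ cong ((1ℚ - P) *_) (*-inv (0<1+ 0≤P)) ⟩
    (1ℚ - P) * 1ℚ                         ≡⟨ ℚ.*-identityʳ (1ℚ - P) ⟩
    1ℚ - P                                ∎
    where
    open ≡-Reasoning
    regroup : ∀ a i b → a * i * b ≡ a * (b * i)
    regroup = solve 3 (λ a i b → a :* i :* b := a :* (b :* i)) refl

  cayley-nonNeg : ∀ {P} → 0ℚ ≤ P → P ≤ 1ℚ → 0ℚ ≤ cayley P
  cayley-nonNeg {P} 0≤P P≤1 =
    ≤-by-scaled-gap (0<1+ 0≤P) (trans (commute (cayley P) P) (cayley-spec 0≤P)) (p≤q⇒0≤q-p P≤1)
    where
    commute : ∀ s P → (1ℚ + P) * s - (1ℚ + P) * 0ℚ ≡ s * (1ℚ + P)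
    commute = solve 2 (λ s P → (con 1ℚ :+ P) :* s :- (con 1ℚ :+ P) :* con 0ℚ := s :* (con 1ℚ :+ P)) refl

  cayley-≤½ : ∀ {P} → 0ℚ ≤ P → 1ℚ ≤ 3ℚ * P → cayley P ≤ ½
  cayley-≤½ {P} 0≤P 1≤3P = ≤-by-scaled-gap (0<1+ 0≤P) gap (*-nonNeg 0≤½ (p≤q⇒0≤q-p 1≤3P))
    where
    open ≡-Reasoning
    commute : ∀ s P → (1ℚ + P) * ½ - (1ℚ + P) * s ≡ (1ℚ + P) * ½ - s * (1ℚ + P)
    commute = solve 2 (λ s P →
      (con 1ℚ :+ P) :* con ½ :- (con 1ℚ :+ P) :* s := (con 1ℚ :+ P) :* con ½ :- s :* (con 1ℚ :+ P)) refl
    simplify : ∀ P → (1ℚ + P) * ½ - (1ℚ - P) ≡ ½ * (3ℚ * P - 1ℚ)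
    simplify = solve 1 (λ P →
      (con 1ℚ :+ P) :* con ½ :- (con 1ℚ :- P) := con ½ :* (con 3ℚ :* P :- con 1ℚ)) refl
    gap : (1ℚ + P) * ½ - (1ℚ + P) * cayley P ≡ ½ * (3ℚ * P - 1ℚ)
    gap = begin
      (1ℚ + P) * ½ - (1ℚ + P) * cayley P  ≡⟨ commute (cayley P) P ⟩
      (1ℚ + P) * ½ - cayley P * (1ℚ + P)  ≡⟨ cong (λ u → (1ℚ + P) * ½ - u) (cayley-spec 0≤P) ⟩
      (1ℚ + P) * ½ - (1ℚ - P)             ≡⟨ simplify P ⟩
      ½ * (3ℚ * P - 1ℚ)                   ∎

  3P-1≡2[1+P][½-cayley] : ∀ {P} → 0ℚ ≤ P → 3ℚ * P - 1ℚ ≡ 2ℚ * (1ℚ + P) * (½ - cayley P)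
  3P-1≡2[1+P][½-cayley] {P} 0≤P = begin
    3ℚ * P - 1ℚ                                        ≡⟨ expand P ⟩
    2ℚ * (1ℚ + P) * ½ - 2ℚ * (1ℚ - P)                  ≡⟨ cong (λ u → 2ℚ * (1ℚ + P) * ½ - 2ℚ * u) (cayley-spec 0≤P) ⟨
    2ℚ * (1ℚ + P) * ½ - 2ℚ * (cayley P * (1ℚ + P))     ≡⟨ factor (cayley P) P ⟩
    2ℚ * (1ℚ + P) * (½ - cayley P)                     ∎
    where
    open ≡-Reasoning
    expand : ∀ P → 3ℚ * P - 1ℚ ≡ 2ℚ * (1ℚ + P) * ½ - 2ℚ * (1ℚ - P)
    expand = solve 1 (λ P →
      con 3ℚ :* P :- con 1ℚ := con 2ℚ :* (con 1ℚ :+ P) :* con ½ :- con 2ℚ :* (con 1ℚ :- P)) refl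
    factor : ∀ s P → 2ℚ * (1ℚ + P) * ½ - 2ℚ * (s * (1ℚ + P)) ≡ 2ℚ * (1ℚ + P) * (½ - s)
    factor = solve 2 (λ s P →
      con 2ℚ :* (con 1ℚ :+ P) :* con ½ :- con 2ℚ :* (s :* (con 1ℚ :+ P))
      := con 2ℚ :* (con 1ℚ :+ P) :* (con ½ :- s)) refl

  cayley-antitone : ∀ {P Q} → 0ℚ ≤ Q → Q ≤ P → cayley P ≤ cayley Q
  cayley-antitone {P} {Q} 0≤Q Q≤P =
    ≤-by-scaled-gap (*-pos (0<1+ 0≤P) (0<1+ 0≤Q)) gap (*-nonNeg 0≤2 (p≤q⇒0≤q-p Q≤P))
    where
    open ≡-Reasoning
    0≤P = ℚ.≤-trans 0≤Q Q≤P
    c = (1ℚ + P) * (1ℚ + Q)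
    commute : ∀ s t P Q → (1ℚ + P) * (1ℚ + Q) * t - (1ℚ + P) * (1ℚ + Q) * s
                        ≡ (1ℚ + P) * (t * (1ℚ + Q)) - (1ℚ + Q) * (s * (1ℚ + P))
    commute = solve 4 (λ s t P Q →
      (con 1ℚ :+ P) :* (con 1ℚ :+ Q) :* t :- (con 1ℚ :+ P) :* (con 1ℚ :+ Q) :* s
      := (con 1ℚ :+ P) :* (t :* (con 1ℚ :+ Q)) :- (con 1ℚ :+ Q) :* (s :* (con 1ℚ :+ P))) refl
    simplify : ∀ P Q → (1ℚ + P) * (1ℚ - Q) - (1ℚ + Q) * (1ℚ - P) ≡ 2ℚ * (P - Q)
    simplify = solve 2 (λ P Q →
      (con 1ℚ :+ P) :* (con 1ℚ :- Q) :- (con 1ℚ :+ Q) :* (con 1ℚ :- P) := con 2ℚ :* (P :- Q)) refl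
    gap : c * cayley Q - c * cayley P ≡ 2ℚ * (P - Q)
    gap = begin
      c * cayley Q - c * cayley P                                              ≡⟨ commute (cayley P) (cayley Q) P Q ⟩
      (1ℚ + P) * (cayley Q * (1ℚ + Q)) - (1ℚ + Q) * (cayley P * (1ℚ + P))
        ≡⟨ cong₂ (λ u v → (1ℚ + P) * v - (1ℚ + Q) * u) (cayley-spec 0≤P) (cayley-spec 0≤Q) ⟩
      (1ℚ + P) * (1ℚ - Q) - (1ℚ + Q) * (1ℚ - P)                                ≡⟨ simplify P Q ⟩
      2ℚ * (P - Q)                                                             ∎

  cayley-step-gap : ∀ {P x} → 0ℚ ≤ P → 0ℚ ≤ P * (1ℚ - x) →
    let s = cayley P; s′ = cayley (P * (1ℚ - x)); c = (1ℚ + P) * (1ℚ + P) * (1ℚ + P * (1ℚ - x)) in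
    c * (2ℚ * (s′ - s)) - c * (x * (1ℚ - s * s)) ≡ 2ℚ * 2ℚ * (P * x) * (P * x)
  cayley-step-gap {P} {x} 0≤P 0≤P′ = begin
    c * (2ℚ * (s′ - s)) - c * (x * (1ℚ - s * s))
      ≡⟨ expand s s′ P P′ x ⟩
    2ℚ * (1ℚ + P) * ((1ℚ + P) * (s′ * (1ℚ + P′)) - (1ℚ + P′) * (s * (1ℚ + P)))
      - x * (1ℚ + P′) * ((1ℚ + P) * (1ℚ + P) - (s * (1ℚ + P)) * (s * (1ℚ + P)))
      ≡⟨ cong₂ (λ u v → 2ℚ * (1ℚ + P) * ((1ℚ + P) * v - (1ℚ + P′) * u)
                         - x * (1ℚ + P′) * ((1ℚ + P) * (1ℚ + P) - u * u))
               (cayley-spec 0≤P) (cayley-spec 0≤P′) ⟩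
    2ℚ * (1ℚ + P) * ((1ℚ + P) * (1ℚ - P′) - (1ℚ + P′) * (1ℚ - P))
      - x * (1ℚ + P′) * ((1ℚ + P) * (1ℚ + P) - (1ℚ - P) * (1ℚ - P))
      ≡⟨ simplify P x ⟩
    2ℚ * 2ℚ * (P * x) * (P * x)
      ∎
    where
    open ≡-Reasoning
    P′ = P * (1ℚ - x)
    s = cayley P
    s′ = cayley P′
    c = (1ℚ + P) * (1ℚ + P) * (1ℚ + P′)
    expand : ∀ s t P Q x →
      (1ℚ + P) * (1ℚ + P) * (1ℚ + Q) * (2ℚ * (t - s)) - (1ℚ + P) * (1ℚ + P) * (1ℚ + Q) * (x * (1ℚ - s * s))
      ≡ 2ℚ * (1ℚ + P) * ((1ℚ + P) * (t * (1ℚ + Q)) - (1ℚ + Q) * (s * (1ℚ + P)))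
        - x * (1ℚ + Q) * ((1ℚ + P) * (1ℚ + P) - (s * (1ℚ + P)) * (s * (1ℚ + P)))
    expand = solve 5 (λ s t P Q x →
      (con 1ℚ :+ P) :* (con 1ℚ :+ P) :* (con 1ℚ :+ Q) :* (con 2ℚ :* (t :- s))
        :- (con 1ℚ :+ P) :* (con 1ℚ :+ P) :* (con 1ℚ :+ Q) :* (x :* (con 1ℚ :- s :* s))
      := con 2ℚ :* (con 1ℚ :+ P) :* ((con 1ℚ :+ P) :* (t :* (con 1ℚ :+ Q)) :- (con 1ℚ :+ Q) :* (s :* (con 1ℚ :+ P)))
        :- x :* (con 1ℚ :+ Q) :* ((con 1ℚ :+ P) :* (con 1ℚ :+ P) :- (s :* (con 1ℚ :+ P)) :* (s :* (con 1ℚ :+ P)))) refl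
    simplify : ∀ P x →
      2ℚ * (1ℚ + P) * ((1ℚ + P) * (1ℚ - P * (1ℚ - x)) - (1ℚ + P * (1ℚ - x)) * (1ℚ - P))
        - x * (1ℚ + P * (1ℚ - x)) * ((1ℚ + P) * (1ℚ + P) - (1ℚ - P) * (1ℚ - P))
      ≡ 2ℚ * 2ℚ * (P * x) * (P * x)
    simplify = solve 2 (λ P x →
      con 2ℚ :* (con 1ℚ :+ P) :* ((con 1ℚ :+ P) :* (con 1ℚ :- P :* (con 1ℚ :- x)) :- (con 1ℚ :+ P :* (con 1ℚ :- x)) :* (con 1ℚ :- P))
        :- x :* (con 1ℚ :+ P :* (con 1ℚ :- x)) :* ((con 1ℚ :+ P) :* (con 1ℚ :+ P) :- (con 1ℚ :- P) :* (con 1ℚ :- P))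
      := con 2ℚ :* con 2ℚ :* (P :* x) :* (P :* x)) refl

  -- A strengthening of x ≤ ln (1 / (1 - x)) = 2 artanh s′ - 2 artanh s, where s = cayley P and
  -- s′ = cayley (P (1 - x)): the right side is replaced by its linearisation 2 (s′ - s) / (1 - s²) at s.
  cayley-step : ∀ {P x} → 0ℚ ≤ P → 0ℚ ≤ x → x ≤ 1ℚ →
    x * (1ℚ - cayley P * cayley P) ≤ 2ℚ * (cayley (P * (1ℚ - x)) - cayley P)
  cayley-step {P} {x} 0≤P 0≤x x≤1 =
    ≤-by-scaled-gap (*-pos (*-pos (0<1+ 0≤P) (0<1+ 0≤P)) (0<1+ 0≤P′)) (cayley-step-gap 0≤P 0≤P′)
                    (*-nonNeg (*-nonNeg (*-nonNeg 0≤2 0≤2) 0≤Px) 0≤Px)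
    where
    0≤P′ = *-nonNeg 0≤P (p≤q⇒0≤q-p x≤1)
    0≤Px = *-nonNeg 0≤P 0≤x

  -- Products of the form ∏ (1 - xᵢ)

  0≤_≤1 : ℚ → Set
  0≤ x ≤1 = 0ℚ ≤ x × x ≤ 1ℚ

  survival : List ℚ → ℚ
  survival []       = 1ℚ
  survival (x ∷ xs) = (1ℚ - x) * survival xs

  sumℚ : List ℚ → ℚ
  sumℚ []       = 0ℚ
  sumℚ (x ∷ xs) = x + sumℚ xs

  1-x-unit : ∀ {x} → 0≤ x ≤1 → 0≤ 1ℚ - x ≤1
  1-x-unit {x} (0≤x , x≤1) = p≤q⇒0≤q-p x≤1 , ≤-by-gap (cancel x) 0≤x
    where
    cancel : ∀ x → 1ℚ - (1ℚ - x) ≡ x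
    cancel = solve 1 (λ x → con 1ℚ :- (con 1ℚ :- x) := x) refl

  *-unit : ∀ {p q} → 0≤ p ≤1 → 0≤ q ≤1 → 0≤ p * q ≤1
  *-unit {p} {q} (0≤p , p≤1) (0≤q , q≤1) = *-nonNeg 0≤p 0≤q , (begin
    p * q   ≤⟨ *-monoʳ-≤-nonNeg′ 0≤q p≤1 ⟩
    1ℚ * q  ≡⟨ ℚ.*-identityˡ q ⟩
    q       ≤⟨ q≤1 ⟩
    1ℚ      ∎)
    where open ℚ.≤-Reasoning

  survival-unit : ∀ {xs} → All 0≤_≤1 xs → 0≤ survival xs ≤1
  survival-unit []         = 0≤1 , ℚ.≤-refl
  survival-unit (x∈ ∷ xs∈) = *-unit (1-x-unit x∈) (survival-unit xs∈)

  logRatio-step : ∀ M {P x} → 0≤ x ≤1 → 0≤ P ≤1 → 1ℚ ≤ 3ℚ * (P * (1ℚ - x)) →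
    (1ℚ - quarterPow M) * x ≤ logRatio M (cayley (P * (1ℚ - x))) - logRatio M (cayley P)
  logRatio-step M {P} {x} (0≤x , x≤1) (0≤P , P≤1) 1≤3P′ = begin
    (1ℚ - quarterPow M) * x      ≡⟨ ℚ.*-comm (1ℚ - quarterPow M) x ⟩
    x * (1ℚ - quarterPow M)      ≤⟨ *-monoˡ-≤-nonNeg′ 0≤x (ℚ.+-monoʳ-≤ 1ℚ (ℚ.neg-antimono-≤ s²ᴹ≤quarterPow)) ⟩
    x * (1ℚ - (s * s) ^ M)       ≡⟨ cong (x *_) (geometric-closed s M) ⟨
    x * ((1ℚ - s * s) * G)       ≡⟨ ℚ.*-assoc x (1ℚ - s * s) G ⟨
    x * (1ℚ - s * s) * G         ≤⟨ *-monoʳ-≤-nonNeg′ (geometric-nonNeg 0≤s M) (cayley-step 0≤P 0≤x x≤1) ⟩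
    2ℚ * (s′ - s) * G            ≤⟨ logRatio-increment 0≤s s≤s′ M ⟩
    logRatio M s′ - logRatio M s ∎
    where
    open ℚ.≤-Reasoning
    P′ = P * (1ℚ - x)
    0≤P′ = *-nonNeg 0≤P (p≤q⇒0≤q-p x≤1)
    s = cayley P
    s′ = cayley P′
    G = geometric M s
    0≤s = cayley-nonNeg 0≤P P≤1
    P′≤P : P′ ≤ P
    P′≤P = ≤-by-gap (drop P x) (*-nonNeg 0≤P 0≤x)
      where
      drop : ∀ P x → P - P * (1ℚ - x) ≡ P * x
      drop = solve 2 (λ P x → P :- P :* (con 1ℚ :- x) := P :* x) refl
    s≤s′ = cayley-antitone 0≤P′ P′≤P
    s≤½ = ℚ.≤-trans s≤s′ (cayley-≤½ 0≤P′ 1≤3P′)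
    s²ᴹ≤quarterPow : (s * s) ^ M ≤ quarterPow M
    s²ᴹ≤quarterPow = ℚ.≤-trans (^-mono-≤ (*-nonNeg 0≤s 0≤s) (ℚ.≤-trans (*-monoˡ-≤-nonNeg′ 0≤s s≤½)
                                                                     (*-monoʳ-≤-nonNeg′ 0≤½ s≤½)) M)
                               (ℚ.≤-reflexive (sym (quarterPow≡[½*½]^ M)))

  logRatio-survival : ∀ M xs {P} → All 0≤_≤1 xs → 0≤ P ≤1 → 1ℚ ≤ 3ℚ * (P * survival xs) →
    (1ℚ - quarterPow M) * sumℚ xs ≤ logRatio M (cayley (P * survival xs)) - logRatio M (cayley P)
  logRatio-survival M [] {P} [] _ _ = begin
    (1ℚ - quarterPow M) * 0ℚ                     ≡⟨ ℚ.*-zeroʳ (1ℚ - quarterPow M) ⟩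
    0ℚ                                           ≡⟨ ℚ.+-inverseʳ (logRatio M (cayley P)) ⟨
    logRatio M (cayley P) - logRatio M (cayley P)
      ≡⟨ cong (λ Q → logRatio M (cayley Q) - logRatio M (cayley P)) (ℚ.*-identityʳ P) ⟨
    logRatio M (cayley (P * 1ℚ)) - logRatio M (cayley P) ∎
    where open ℚ.≤-Reasoning
  logRatio-survival M (x ∷ xs) {P} (x∈ ∷ xs∈) P∈ 1≤3PΠ = begin
    (1ℚ - quarterPow M) * (x + sumℚ xs)
      ≡⟨ ℚ.*-distribˡ-+ (1ℚ - quarterPow M) x (sumℚ xs) ⟩
    (1ℚ - quarterPow M) * x + (1ℚ - quarterPow M) * sumℚ xs
      ≤⟨ ℚ.+-mono-≤ (logRatio-step M x∈ P∈ 1≤3P′) (logRatio-survival M xs xs∈ P′∈ 1≤3P′Π) ⟩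
    (L P′ - L P) + (L (P′ * survival xs) - L P′)
      ≡⟨ telescope (L P′) (L P) (L (P′ * survival xs)) ⟩
    L (P′ * survival xs) - L P
      ≡⟨ cong (λ Q → L Q - L P) (ℚ.*-assoc P (1ℚ - x) (survival xs)) ⟩
    L (P * survival (x ∷ xs)) - L P ∎
    where
    open ℚ.≤-Reasoning
    L = λ Q → logRatio M (cayley Q)
    P′ = P * (1ℚ - x)
    P′∈ = *-unit P∈ (1-x-unit x∈)
    1≤3P′Π : 1ℚ ≤ 3ℚ * (P′ * survival xs)
    1≤3P′Π = ℚ.≤-trans 1≤3PΠ (ℚ.≤-reflexive (cong (3ℚ *_) (sym (ℚ.*-assoc P (1ℚ - x) (survival xs)))))
    1≤3P′ : 1ℚ ≤ 3ℚ * P′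
    1≤3P′ = ℚ.≤-trans 1≤3P′Π (*-monoˡ-≤-nonNeg′ (0≤fromℕ 3)
              (ℚ.≤-trans (*-monoˡ-≤-nonNeg′ (proj₁ P′∈) (proj₂ (survival-unit xs∈)))
                         (ℚ.≤-reflexive (ℚ.*-identityʳ P′))))
    telescope : ∀ a b c → (a - b) + (c - a) ≡ c - b
    telescope = solve 3 (λ a b c → (a :- b) :+ (c :- a) := c :- b) refl

  ½-cayley≤quarterPow : ∀ {xs} → All 0≤_≤1 xs → (∀ m → ln3Partial m ≤ sumℚ xs) →
    1ℚ ≤ 3ℚ * survival xs → ∀ M → ½ - cayley (survival xs) ≤ quarterPow (suc M)
  ½-cayley≤quarterPow {xs} xs∈ ln3≤Σ 1≤3Π M = *-cancelˡ-≤-pos′ (ℚ.positive⁻¹ 2ℚ) (begin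
    2ℚ * (½ - s)                   ≡⟨ ℚ.*-identityʳ _ ⟨
    2ℚ * (½ - s) * 1ℚ              ≤⟨ *-monoˡ-≤-nonNeg′ (*-nonNeg 0≤2 (p≤q⇒0≤q-p s≤½)) (1≤geometric 0≤s M) ⟩
    2ℚ * (½ - s) * geometric M₁ s  ≤⟨ logRatio-increment 0≤s s≤½ M₁ ⟩
    A ½ - A s                      ≤⟨ ℚ.+-monoʳ-≤ (A ½) (ℚ.neg-antimono-≤ Σ≤A) ⟩
    A ½ - (1ℚ - e) * sumℚ xs       ≤⟨ ℚ.+-monoʳ-≤ (A ½) (ℚ.neg-antimono-≤ (*-monoˡ-≤-nonNeg′ 0≤1-e A½≤Σ)) ⟩
    A ½ - (1ℚ - e) * A ½           ≡⟨ residual (A ½) e ⟩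
    e * A ½                        ≤⟨ *-monoˡ-≤-nonNeg′ (0≤quarterPow M₁) A½≤2 ⟩
    e * 2ℚ                         ≡⟨ ℚ.*-comm e 2ℚ ⟩
    2ℚ * e                         ∎)
    where
    open ℚ.≤-Reasoning
    M₁ = suc M
    e = quarterPow M₁
    A = logRatio M₁
    Π = survival xs
    s = cayley Π
    Π∈ = survival-unit xs∈
    0≤s = cayley-nonNeg (proj₁ Π∈) (proj₂ Π∈)
    s≤½ = cayley-≤½ (proj₁ Π∈) 1≤3Π
    0≤1-e = p≤q⇒0≤q-p (quarterPow≤1 M₁)
    A½≤Σ = subst (_≤ sumℚ xs) (sym (logRatio-½ M₁)) (ln3≤Σ M₁)
    A½≤2 = subst (_≤ 2ℚ) (sym (logRatio-½ M₁)) (ln3Partial≤2 M₁)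
    residual : ∀ a e → a - (1ℚ - e) * a ≡ e * a
    residual = solve 2 (λ a e → a :- (con 1ℚ :- e) :* a := e :* a) refl
    Σ≤A : (1ℚ - e) * sumℚ xs ≤ A s
    Σ≤A = begin
      (1ℚ - e) * sumℚ xs                   ≤⟨ logRatio-survival M₁ xs xs∈ (0≤1 , ℚ.≤-refl)
                                                (subst (λ Q → 1ℚ ≤ 3ℚ * Q) (sym (ℚ.*-identityˡ Π)) 1≤3Π) ⟩
      A (cayley (1ℚ * Π)) - A (cayley 1ℚ)  ≡⟨ cong₂ (λ Q z → A (cayley Q) - z) (ℚ.*-identityˡ Π) (logRatio-0 M₁) ⟩
      A s - 0ℚ                             ≡⟨ ℚ.+-identityʳ (A s) ⟩
      A s                                  ∎

  3Π-1≤quarterPow : ∀ {xs} → All 0≤_≤1 xs → (∀ m → ln3Partial m ≤ sumℚ xs) →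
    1ℚ ≤ 3ℚ * survival xs → ∀ M → 3ℚ * survival xs - 1ℚ ≤ quarterPow M
  3Π-1≤quarterPow {xs} xs∈ ln3≤Σ 1≤3Π M = begin
    3ℚ * Π - 1ℚ                 ≡⟨ 3P-1≡2[1+P][½-cayley] 0≤Π ⟩
    2ℚ * (1ℚ + Π) * (½ - s)     ≤⟨ *-monoʳ-≤-nonNeg′ (p≤q⇒0≤q-p s≤½) (*-monoˡ-≤-nonNeg′ 0≤2 (ℚ.+-monoʳ-≤ 1ℚ Π≤1)) ⟩
    2ℚ * 2ℚ * (½ - s)           ≤⟨ *-monoˡ-≤-nonNeg′ (*-nonNeg 0≤2 0≤2) (½-cayley≤quarterPow xs∈ ln3≤Σ 1≤3Π M) ⟩
    2ℚ * 2ℚ * quarterPow (suc M) ≡⟨ quadruple (quarterPow M) ⟩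
    quarterPow M                ∎
    where
    open ℚ.≤-Reasoning
    Π = survival xs
    0≤Π = proj₁ (survival-unit xs∈)
    Π≤1 = proj₂ (survival-unit xs∈)
    s = cayley Π
    s≤½ = cayley-≤½ 0≤Π 1≤3Π
    quadruple : ∀ q → 2ℚ * 2ℚ * ((ℤ.+ 1 / 4) * q) ≡ q
    quadruple = solve 1 (λ q → con 2ℚ :* con 2ℚ :* ((con (ℤ.+ 1 / 4)) :* q) := q) refl

  module Rescaling (n : ℕ) (ι : ℚ) (nι≡1 : fromℕ n * ι ≡ 1ℚ) where

    scale : ℕ → ℚ
    scale h = fromℕ h * ι

    sumℚ-scale : ∀ hs → sumℚ (map scale hs) ≡ fromℕ (sum hs) * ι
    sumℚ-scale []       = sym (ℚ.*-zeroˡ ι)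
    sumℚ-scale (h ∷ hs) = begin
      fromℕ h * ι + sumℚ (map scale hs)    ≡⟨ cong (fromℕ h * ι +_) (sumℚ-scale hs) ⟩
      fromℕ h * ι + fromℕ (sum hs) * ι     ≡⟨ ℚ.*-distribʳ-+ ι (fromℕ h) (fromℕ (sum hs)) ⟨
      (fromℕ h + fromℕ (sum hs)) * ι       ≡⟨ cong (_* ι) (fromℕ-+ h (sum hs)) ⟨
      fromℕ (sum (h ∷ hs)) * ι             ∎
      where open ≡-Reasoning

    survival-scale : ∀ {hs} → All (ℕ._≤ n) hs →
      survival (map scale hs) ≡ fromℕ (product (map (n ℕ.∸_) hs)) * ι ^ length hs
    survival-scale []                = sym (ℚ.*-identityˡ 1ℚ)
    survival-scale {h ∷ hs} (h≤n ∷ hs≤n) = begin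
      (1ℚ - fromℕ h * ι) * survival (map scale hs)
        ≡⟨ cong₂ (λ u v → (u - fromℕ h * ι) * v) (sym nι≡1) (survival-scale hs≤n) ⟩
      (fromℕ n * ι - fromℕ h * ι) * (fromℕ B * ι ^ length hs)
        ≡⟨ regroup (fromℕ n) (fromℕ h) ι (fromℕ B) (ι ^ length hs) ⟩
      (fromℕ n - fromℕ h) * fromℕ B * (ι * ι ^ length hs)
        ≡⟨ cong (λ d → d * fromℕ B * (ι * ι ^ length hs)) (fromℕ-∸ h≤n) ⟨
      fromℕ (n ℕ.∸ h) * fromℕ B * ι ^ length (h ∷ hs)    ≡⟨ cong (_* ι ^ length (h ∷ hs)) (fromℕ-* (n ℕ.∸ h) B) ⟨
      fromℕ ((n ℕ.∸ h) ℕ.* B) * ι ^ length (h ∷ hs)      ∎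
      where
      open ≡-Reasoning
      B = product (map (n ℕ.∸_) hs)
      regroup : ∀ N h i b w → (N * i - h * i) * (b * w) ≡ (N - h) * b * (i * w)
      regroup = solve 5 (λ N h i b w → (N :* i :- h :* i) :* (b :* w) := (N :- h) :* b :* (i :* w)) refl

    scale-unit : 0ℚ ≤ ι → ∀ {hs} → All (ℕ._≤ n) hs → All 0≤_≤1 (map scale hs)
    scale-unit 0≤ι []                   = []
    scale-unit 0≤ι {h ∷ _} (h≤n ∷ hs≤n) =
      (*-nonNeg (0≤fromℕ h) 0≤ι , ℚ.≤-trans (*-monoʳ-≤-nonNeg′ 0≤ι (fromℕ-mono-≤ h≤n)) (ℚ.≤-reflexive nι≡1))
      ∷ scale-unit 0≤ι hs≤n

    scale-^ : ∀ k → fromℕ (n ℕ.^ k) * ι ^ k ≡ 1ℚ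
    scale-^ k = begin
      fromℕ (n ℕ.^ k) * ι ^ k  ≡⟨ cong (_* ι ^ k) (fromℕ-^ n k) ⟩
      fromℕ n ^ k * ι ^ k      ≡⟨ ^-distrib-* (fromℕ n) ι k ⟨
      (fromℕ n * ι) ^ k        ≡⟨ cong (_^ k) nι≡1 ⟩
      1ℚ ^ k                   ≡⟨ 1^k≡1 k ⟩
      1ℚ                       ∎
      where open ≡-Reasoning

    ln3≤sumℚ-scale : 0ℚ ≤ ι → ∀ {hs} → (∀ m → fromℕ n * ln3Partial m ≤ fromℕ (sum hs)) →
                     ∀ m → ln3Partial m ≤ sumℚ (map scale hs)
    ln3≤sumℚ-scale 0≤ι {hs} n*ln3≤Σ m = begin
      ln3Partial m                  ≡⟨ ℚ.*-identityˡ _ ⟨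
      1ℚ * ln3Partial m             ≡⟨ cong (_* ln3Partial m) (trans (ℚ.*-comm ι (fromℕ n)) nι≡1) ⟨
      ι * fromℕ n * ln3Partial m    ≡⟨ ℚ.*-assoc ι (fromℕ n) (ln3Partial m) ⟩
      ι * (fromℕ n * ln3Partial m)  ≤⟨ *-monoˡ-≤-nonNeg′ 0≤ι (n*ln3≤Σ m) ⟩
      ι * fromℕ (sum hs)            ≡⟨ ℚ.*-comm ι (fromℕ (sum hs)) ⟩
      fromℕ (sum hs) * ι            ≡⟨ sumℚ-scale hs ⟨
      sumℚ (map scale hs)           ∎
      where open ℚ.≤-Reasoning

  3*∏[n∸h]≤n^length : ∀ n → 1 ℕ.≤ n → (hs : List ℕ) → All (ℕ._≤ n) hs →
    (∀ m → fromℕ n * ln3Partial m ≤ fromℕ (sum hs)) →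
    3 ℕ.* product (map (n ℕ.∸_) hs) ℕ.≤ n ℕ.^ length hs
  3*∏[n∸h]≤n^length n 1≤n hs hs≤n n*ln3≤Σ =
    ℕ.≮⇒≥ λ K<3B → ℚ.<-irrefl refl (ℚ.≤-<-trans (1≤K*quarterPow K<3B) (K*quarterPow<1 K))
    where
    open ℚ.≤-Reasoning
    B = product (map (n ℕ.∸_) hs)
    K = n ℕ.^ length hs
    0<n : 0ℚ < fromℕ n
    0<n = subst (λ k → 0ℚ < fromℕ k) (ℕ.suc-pred n {{ℕ.>-nonZero 1≤n}}) (0<fromℕ (ℕ.pred n))
    ι = inv (fromℕ n)
    0≤ι = 0≤inv 0<n
    open Rescaling n ι (*-inv 0<n)
    W = ι ^ length hs
    Π = survival (map scale hs)
    1+W≤3Π : K ℕ.< 3 ℕ.* B → 1ℚ + W ≤ 3ℚ * Π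
    1+W≤3Π K<3B = begin
      1ℚ + W               ≡⟨ cong (_+ W) (scale-^ (length hs)) ⟨
      fromℕ K * W + W      ≡⟨ absorb (fromℕ K) W ⟩
      (1ℚ + fromℕ K) * W   ≡⟨ cong (_* W) (fromℕ-suc K) ⟨
      fromℕ (suc K) * W    ≤⟨ *-monoʳ-≤-nonNeg′ (^-nonNeg 0≤ι (length hs)) (fromℕ-mono-≤ K<3B) ⟩
      fromℕ (3 ℕ.* B) * W  ≡⟨ cong (_* W) (fromℕ-* 3 B) ⟩
      3ℚ * fromℕ B * W     ≡⟨ ℚ.*-assoc 3ℚ (fromℕ B) W ⟩
      3ℚ * (fromℕ B * W)   ≡⟨ cong (3ℚ *_) (survival-scale hs≤n) ⟨
      3ℚ * Π               ∎
      where
      absorb : ∀ k w → k * w + w ≡ (1ℚ + k) * w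
      absorb = solve 2 (λ k w → k :* w :+ w := (con 1ℚ :+ k) :* w) refl
    1≤K*quarterPow : K ℕ.< 3 ℕ.* B → 1ℚ ≤ fromℕ K * quarterPow K
    1≤K*quarterPow K<3B = begin
      1ℚ                      ≡⟨ scale-^ (length hs) ⟨
      fromℕ K * W             ≤⟨ *-monoˡ-≤-nonNeg′ (0≤fromℕ K) W≤quarterPow ⟩
      fromℕ K * quarterPow K  ∎
      where
      0≤W = ^-nonNeg 0≤ι (length hs)
      cancel : ∀ w → 1ℚ + w - 1ℚ ≡ w
      cancel = solve 1 (λ w → con 1ℚ :+ w :- con 1ℚ := w) refl
      shift : ∀ a w → a - 1ℚ - w ≡ a - (1ℚ + w)
      shift = solve 2 (λ a w → a :- con 1ℚ :- w := a :- (con 1ℚ :+ w)) refl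
      1≤3Π = ℚ.≤-trans (≤-by-gap (cancel W) 0≤W) (1+W≤3Π K<3B)
      W≤quarterPow : W ≤ quarterPow K
      W≤quarterPow = ℚ.≤-trans (≤-by-gap (shift (3ℚ * Π) W) (p≤q⇒0≤q-p (1+W≤3Π K<3B)))
                               (3Π-1≤quarterPow (scale-unit 0≤ι hs≤n) (ln3≤sumℚ-scale 0≤ι {hs} n*ln3≤Σ) 1≤3Π K)

  length*≤sum : ∀ {A : Set} (w : A → ℕ) {c : ℚ} {xs : List A} → All (λ x → c ≤ fromℕ (w x)) xs →
    fromℕ (length xs) * c ≤ fromℕ (sum (map w xs))
  length*≤sum w {c} []                 = ℚ.≤-reflexive (ℚ.*-zeroˡ c)
  length*≤sum w {c} {x ∷ xs} (c≤wx ∷ c≤w) = begin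
    fromℕ (suc (length xs)) * c          ≡⟨ cong (_* c) (fromℕ-suc (length xs)) ⟩
    (1ℚ + fromℕ (length xs)) * c         ≡⟨ distrib c (fromℕ (length xs)) ⟩
    c + fromℕ (length xs) * c            ≤⟨ ℚ.+-mono-≤ c≤wx (length*≤sum w c≤w) ⟩
    fromℕ (w x) + fromℕ (sum (map w xs)) ≡⟨ fromℕ-+ (w x) (sum (map w xs)) ⟨
    fromℕ (sum (map w (x ∷ xs)))         ∎
    where
    open ℚ.≤-Reasoning
    distrib : ∀ c l → (1ℚ + l) * c ≡ c + l * c
    distrib = solve 2 (λ c l → (con 1ℚ :+ l) :* c := c :+ l :* c) refl

  halve : ∀ {n k q} → fromℕ (2 ℕ.* n) * q ≤ fromℕ (2 ℕ.* k) → fromℕ n * q ≤ fromℕ k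
  halve {n} {k} {q} 2nq≤2k = *-cancelˡ-≤-pos′ (0<fromℕ 1) (begin
    2ℚ * (fromℕ n * q)     ≡⟨ ℚ.*-assoc 2ℚ (fromℕ n) q ⟨
    2ℚ * fromℕ n * q       ≡⟨ cong (_* q) (fromℕ-* 2 n) ⟨
    fromℕ (2 ℕ.* n) * q    ≤⟨ 2nq≤2k ⟩
    fromℕ (2 ℕ.* k)        ≡⟨ fromℕ-* 2 k ⟩
    2ℚ * fromℕ k           ∎)
    where open ℚ.≤-Reasoning

  sum-map-*ˡ : ∀ {A : Set} k (w : A → ℕ) xs → sum (map (λ x → k ℕ.* w x) xs) ≡ k ℕ.* sum (map w xs)
  sum-map-*ˡ k w []       = sym (ℕ.*-zeroʳ k)
  sum-map-*ˡ k w (x ∷ xs) = trans (cong (k ℕ.* w x ℕ.+_) (sum-map-*ˡ k w xs)) (sym (ℕ.*-distribˡ-+ k (w x) _))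

  averaging : ∀ {A : Set} (w : A → ℕ) {N : ℕ} {q : ℚ} {xs : List A} → 1 ℕ.≤ N → N ℕ.≤ length xs → 0ℚ ≤ q →
    All (λ x → q ≤ fromℕ (N ℕ.* w x)) xs → q ≤ fromℕ (sum (map w xs))
  averaging w {suc N} {q} {xs} _ N≤length 0≤q q≤Nw = *-cancelˡ-≤-pos′ (0<fromℕ N) (begin
    fromℕ (suc N) * q                            ≤⟨ *-monoʳ-≤-nonNeg′ 0≤q (fromℕ-mono-≤ N≤length) ⟩
    fromℕ (length xs) * q                        ≤⟨ length*≤sum (λ x → suc N ℕ.* w x) q≤Nw ⟩
    fromℕ (sum (map (λ x → suc N ℕ.* w x) xs))   ≡⟨ cong fromℕ (sum-map-*ˡ (suc N) w xs) ⟩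
    fromℕ (suc N ℕ.* sum (map w xs))             ≡⟨ fromℕ-* (suc N) (sum (map w xs)) ⟩
    fromℕ (suc N) * fromℕ (sum (map w xs))       ∎)
    where open ℚ.≤-Reasoning

open ProductBound using (0≤fromℕ; fromℕ-mono-≤; *-nonNeg; 0≤ln3Partial; 3*∏[n∸h]≤n^length; halve; averaging)

open import Data.Empty using (⊥-elim)
open import Data.Fin using (Fin; toℕ)
open import Data.List
  using (List; []; _∷_; [_]; _++_; map; concat; replicate; upTo; applyUpTo; length; filter; tabulate; allFin;
         cartesianProductWith; zipWith; take; drop)
import Data.List.Properties as List
open import Data.List.Membership.Propositional using (_∈_; find; lose)
open import Data.List.Membership.Propositional.Properties using (∈-filter⁻; ∈-upTo⁺)
open import Data.List.Relation.Unary.All as All using (All; []; _∷_)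
import Data.List.Relation.Unary.All.Properties as All
open import Data.List.Relation.Unary.AllPairs using (AllPairs; []; _∷_)
import Data.List.Relation.Unary.AllPairs.Properties as AllPairs
open import Data.List.Relation.Unary.Any using (Any; here; there; any?)
open import Data.List.Relation.Unary.Unique.Propositional using (Unique)
import Data.List.Relation.Unary.Unique.Propositional.Properties as Unique
open import Data.Nat as ℕ using (ℕ; zero; suc; _+_; _*_; _∸_; _^_; _≤_; _<_; z≤n; s≤s; ⌈_/2⌉; ⌊_/2⌋)
import Data.Nat.Properties as ℕ
open import Data.Nat.Induction using (<-rec)
open import Data.Nat.ListAction using (sum; product)
open import Data.Nat.ListAction.Properties using (sum-++)
open import Data.Nat.Logarithm using (⌈log₂_⌉; ⌈log₂⌉-mono-≤; ⌈log₂⌈n/2⌉⌉≡⌈log₂n⌉∸1; ⌈log₂2^n⌉≡n)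
open import Data.Nat.Tactic.RingSolver using (solve-∀)
open import Data.Product using (_×_; _,_; proj₁; proj₂)
import Data.Rational as ℚ
import Data.Rational.Properties as ℚ
open import Data.Sum using (inj₁; inj₂)
open import Data.Unit using (⊤; tt)
open import Data.Vec using (Vec; toList; _∷_) renaming ([] to []ᵥ)
open import Function using (_∘_)
open import Level using (0ℓ)
open import Relation.Binary.PropositionalEquality
  using (_≡_; refl; sym; trans; cong; cong₂; subst; subst₂; module ≡-Reasoning)
open import Relation.Nullary using (Dec; yes; no; ¬_; ¬?)
open import Relation.Nullary.Decidable using (_×-dec_)
open import Relation.Unary using (Pred; Decidable; _⊆_)
open import Relation.Unary.Properties using (∁?)

module _ {A : Set} where

  count : {P : Pred A 0ℓ} → Decidable P → List A → ℕ
  count P? xs = length (filter P? xs)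

  module _ {P : Pred A 0ℓ} (P? : Decidable P) where

    count-++ : ∀ xs ys → count P? (xs ++ ys) ≡ count P? xs + count P? ys
    count-++ xs ys = trans (cong length (List.filter-++ P? xs ys)) (List.length-++ (filter P? xs))

    count+count-∁ : ∀ xs → count P? xs + count (∁? P?) xs ≡ length xs
    count+count-∁ []       = refl
    count+count-∁ (x ∷ xs) with P? x
    ... | yes _ = cong suc (count+count-∁ xs)
    ... | no  _ = trans (ℕ.+-suc _ _) (cong suc (count+count-∁ xs))

    count-none : (∀ x → ¬ P x) → ∀ xs → count P? xs ≡ 0
    count-none ¬P xs = cong length (List.filter-none P? (All.universal ¬P xs))

  count-mono : {P Q : Pred A 0ℓ} (P? : Decidable P) (Q? : Decidable Q) → P ⊆ Q →
               ∀ xs → count P? xs ≤ count Q? xs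
  count-mono P? Q? P⊆Q []       = z≤n
  count-mono P? Q? P⊆Q (x ∷ xs) with P? x | Q? x
  ... | yes _  | yes _  = s≤s (count-mono P? Q? P⊆Q xs)
  ... | yes px | no ¬qx = ⊥-elim (¬qx (P⊆Q px))
  ... | no  _  | yes _  = ℕ.m≤n⇒m≤1+n (count-mono P? Q? P⊆Q xs)
  ... | no  _  | no  _  = count-mono P? Q? P⊆Q xs

  count-cong : {P Q : Pred A 0ℓ} (P? : Decidable P) (Q? : Decidable Q) → P ⊆ Q → Q ⊆ P →
               ∀ xs → count P? xs ≡ count Q? xs
  count-cong P? Q? P⊆Q Q⊆P xs = ℕ.≤-antisym (count-mono P? Q? P⊆Q xs) (count-mono Q? P? Q⊆P xs)

  count-disjoint-∪ : {P Q R : Pred A 0ℓ} (P? : Decidable P) (Q? : Decidable Q) (R? : Decidable R) →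
    P ⊆ R → Q ⊆ R → (∀ {x} → P x → ¬ Q x) → ∀ xs → count P? xs + count Q? xs ≤ count R? xs
  count-disjoint-∪ P? Q? R? P⊆R Q⊆R P∩Q=∅ []       = z≤n
  count-disjoint-∪ P? Q? R? P⊆R Q⊆R P∩Q=∅ (x ∷ xs) with P? x | Q? x | R? x
  ... | yes px | yes qx | _      = ⊥-elim (P∩Q=∅ px qx)
  ... | yes px | no  _  | no ¬rx = ⊥-elim (¬rx (P⊆R px))
  ... | no  _  | yes qx | no ¬rx = ⊥-elim (¬rx (Q⊆R qx))
  ... | yes _  | no  _  | yes _  = s≤s (count-disjoint-∪ P? Q? R? P⊆R Q⊆R P∩Q=∅ xs)
  ... | no  _  | yes _  | yes _  = ℕ.≤-trans (ℕ.≤-reflexive (ℕ.+-suc _ _))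
                                     (s≤s (count-disjoint-∪ P? Q? R? P⊆R Q⊆R P∩Q=∅ xs))
  ... | no  _  | no  _  | yes _  = ℕ.m≤n⇒m≤1+n (count-disjoint-∪ P? Q? R? P⊆R Q⊆R P∩Q=∅ xs)
  ... | no  _  | no  _  | no  _  = count-disjoint-∪ P? Q? R? P⊆R Q⊆R P∩Q=∅ xs

count-map : {A B : Set} {P : Pred B 0ℓ} (P? : Decidable P) (f : A → B) →
            ∀ xs → count P? (map f xs) ≡ count (λ x → P? (f x)) xs
count-map P? f []       = refl
count-map P? f (x ∷ xs) with P? (f x)
... | yes _ = cong suc (count-map P? f xs)
... | no  _ = count-map P? f xs

count-cartesianProductWith : {A B C : Set} {P : Pred A 0ℓ} {Q : Pred B 0ℓ} {R : Pred C 0ℓ}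
  (P? : Decidable P) (Q? : Decidable Q) (R? : Decidable R) (f : A → B → C) →
  (∀ {x y} → R (f x y) → P x × Q y) → (∀ {x y} → P x → Q y → R (f x y)) →
  ∀ xs ys → count R? (cartesianProductWith f xs ys) ≡ count P? xs * count Q? ys
count-cartesianProductWith P? Q? R? f R⇒P×Q P×Q⇒R []       ys = refl
count-cartesianProductWith P? Q? R? f R⇒P×Q P×Q⇒R (x ∷ xs) ys = begin
  count R? (map (f x) ys ++ cartesianProductWith f xs ys)
    ≡⟨ count-++ R? (map (f x) ys) _ ⟩
  count R? (map (f x) ys) + count R? (cartesianProductWith f xs ys)
    ≡⟨ cong₂ _+_ (count-map R? (f x) ys)
                 (count-cartesianProductWith P? Q? R? f R⇒P×Q P×Q⇒R xs ys) ⟩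
  count (λ y → R? (f x y)) ys + count P? xs * count Q? ys
    ≡⟨ row ⟩
  count P? (x ∷ xs) * count Q? ys
    ∎
  where
  open ≡-Reasoning
  row : count (λ y → R? (f x y)) ys + count P? xs * count Q? ys ≡ count P? (x ∷ xs) * count Q? ys
  row with P? x
  ... | yes px = cong (_+ count P? xs * count Q? ys)
                      (count-cong _ Q? (λ r → proj₂ (R⇒P×Q r)) (P×Q⇒R px) ys)
  ... | no ¬px = cong (_+ count P? xs * count Q? ys)
                      (count-none _ (λ y r → ¬px (proj₁ (R⇒P×Q r))) ys)

length-cartesianProductWith : {A B C : Set} (f : A → B → C) (xs : List A) (ys : List B) →
                              length (cartesianProductWith f xs ys) ≡ length xs * length ys
length-cartesianProductWith f []       ys = refl
length-cartesianProductWith f (x ∷ xs) ys =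
  trans (List.length-++ (map (f x) ys))
        (cong₂ _+_ (List.length-map (f x) ys) (length-cartesianProductWith f xs ys))

-- Positions covered by disjoint intervals

count-upTo-suc : {P : Pred ℕ 0ℓ} (P? : Decidable P) →
                 ∀ k → count P? (upTo (suc k)) ≡ count P? (upTo k) + count P? [ k ]
count-upTo-suc P? k = trans (cong (count P?) (sym (List.upTo-∷ʳ k))) (count-++ P? (upTo k) [ k ])

count-upTo-mono : {P : Pred ℕ 0ℓ} (P? : Decidable P) →
                  ∀ {m n} → m ≤ n → count P? (upTo m) ≤ count P? (upTo n)
count-upTo-mono P? {m} {zero}  z≤n   = ℕ.≤-refl
count-upTo-mono P? {m} {suc n} m≤1+n with m ℕ.≟ suc n
... | yes refl  = ℕ.≤-refl
... | no  m≢1+n = begin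
  count P? (upTo m)                      ≤⟨ count-upTo-mono P? (ℕ.≤-pred (ℕ.≤∧≢⇒< m≤1+n m≢1+n)) ⟩
  count P? (upTo n)                      ≤⟨ ℕ.m≤m+n _ _ ⟩
  count P? (upTo n) + count P? [ n ]     ≡⟨ count-upTo-suc P? n ⟨
  count P? (upTo (suc n))                ∎
  where open ℕ.≤-Reasoning

count-allFin : {P : Pred ℕ 0ℓ} (P? : Decidable P) →
               ∀ n → count (λ (j : Fin n) → P? (toℕ j)) (allFin n) ≡ count P? (upTo n)
count-allFin P? n = begin
  count (λ j → P? (toℕ j)) (allFin n)  ≡⟨ count-map P? toℕ (allFin n) ⟨
  count P? (map toℕ (allFin n))
    ≡⟨ cong (count P?) (trans (List.map-tabulate (λ i → i) toℕ) (tabulate-toℕ n (λ i → i))) ⟩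
  count P? (upTo n)                    ∎
  where
  open ≡-Reasoning
  tabulate-toℕ : ∀ {A : Set} n (f : ℕ → A) → tabulate (λ (i : Fin n) → f (toℕ i)) ≡ applyUpTo f n
  tabulate-toℕ zero    f = refl
  tabulate-toℕ (suc n) f = cong (f 0 ∷_) (tabulate-toℕ n (λ i → f (suc i)))

_∈ᵢ_ : ℕ → Interval → Set
j ∈ᵢ (a , b) = a ≤ j × j ≤ b

_∈ᵢ?_ : ∀ j s → Dec (j ∈ᵢ s)
j ∈ᵢ? (a , b) = (a ℕ.≤? j) ×-dec (j ℕ.≤? b)

count-∈ᵢ-upTo : ∀ a b k → k ≤ suc b → k ∸ a ≤ count (_∈ᵢ? (a , b)) (upTo k)
count-∈ᵢ-upTo a b zero    _     = ℕ.≤-reflexive (ℕ.0∸n≡0 a)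
count-∈ᵢ-upTo a b (suc k) k<1+b with a ℕ.≤? k
... | no  a≰k = ℕ.≤-trans (ℕ.≤-reflexive (ℕ.m≤n⇒m∸n≡0 (ℕ.≰⇒> a≰k))) z≤n
... | yes a≤k = begin
  suc k ∸ a                    ≡⟨ ℕ.+-∸-assoc 1 a≤k ⟩
  suc (k ∸ a)                  ≤⟨ s≤s (count-∈ᵢ-upTo a b k (ℕ.m≤n⇒m≤1+n k≤b)) ⟩
  suc (c (upTo k))             ≡⟨ ℕ.+-comm 1 (c (upTo k)) ⟩
  c (upTo k) + 1               ≡⟨ cong (λ m → c (upTo k) + length m) (List.filter-accept (_∈ᵢ? (a , b)) (a≤k , k≤b)) ⟨
  c (upTo k) + c [ k ]         ≡⟨ count-upTo-suc (_∈ᵢ? (a , b)) k ⟨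
  c (upTo (suc k))             ∎
  where
  open ℕ.≤-Reasoning
  c = count (_∈ᵢ? (a , b))
  k≤b = ℕ.≤-pred k<1+b

intervalLength≤count : ∀ {n a b} → b < n → intervalLength (a , b) ≤ count (_∈ᵢ? (a , b)) (upTo n)
intervalLength≤count {n} {a} {b} b<n =
  ℕ.≤-trans (count-∈ᵢ-upTo a b (suc b) ℕ.≤-refl) (count-upTo-mono (_∈ᵢ? (a , b)) b<n)

Covered : List Interval → Pred ℕ 0ℓ
Covered S j = Any (j ∈ᵢ_) S

Covered? : ∀ S → Decidable (Covered S)
Covered? S j = any? (j ∈ᵢ?_) S

Disjoint⇒∉ : ∀ {s t j} → Disjoint s t → j ∈ᵢ s → ¬ j ∈ᵢ t
Disjoint⇒∉ (inj₁ b<c) (_ , j≤b) (c≤j , _) = ℕ.<-irrefl refl (ℕ.<-≤-trans b<c (ℕ.≤-trans c≤j j≤b))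
Disjoint⇒∉ (inj₂ d<a) (a≤j , _) (_ , j≤d) = ℕ.<-irrefl refl (ℕ.<-≤-trans d<a (ℕ.≤-trans a≤j j≤d))

Disjoint⇒¬Covered : ∀ {s S j} → All (Disjoint s) S → j ∈ᵢ s → ¬ Covered S j
Disjoint⇒¬Covered (d ∷ _)  j∈s (here j∈t)   = Disjoint⇒∉ d j∈s j∈t
Disjoint⇒¬Covered (_ ∷ ds) j∈s (there j∈S) = Disjoint⇒¬Covered ds j∈s j∈S

sum-length≤count-Covered : ∀ {n} S → All (ValidIn n) S → AllPairs Disjoint S →
                           sum (map intervalLength S) ≤ count (Covered? S) (upTo n)
sum-length≤count-Covered         []            _                _          = z≤n
sum-length≤count-Covered {n} (s ∷ S) ((_ , b<n) ∷ valid) (ds ∷ disjoint) = begin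
  intervalLength s + sum (map intervalLength S)
    ≤⟨ ℕ.+-mono-≤ (intervalLength≤count b<n) (sum-length≤count-Covered S valid disjoint) ⟩
  count (_∈ᵢ? s) (upTo n) + count (Covered? S) (upTo n)
    ≤⟨ count-disjoint-∪ (_∈ᵢ? s) (Covered? S) (Covered? (s ∷ S)) here there (Disjoint⇒¬Covered ds) (upTo n) ⟩
  count (Covered? (s ∷ S)) (upTo n)
    ∎
  where open ℕ.≤-Reasoning

k≤2^⌈log₂k⌉ : ∀ k → k ≤ 2 ^ ⌈log₂ k ⌉
k≤2^⌈log₂k⌉ = <-rec (λ k → k ≤ 2 ^ ⌈log₂ k ⌉) bound
  where
  bound : ∀ k → (∀ {m} → m < k → m ≤ 2 ^ ⌈log₂ m ⌉) → k ≤ 2 ^ ⌈log₂ k ⌉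
  bound zero                _   = z≤n
  bound (suc zero)          _   = ℕ.≤-refl
  bound k@(suc (suc m)) rec = begin
    k                                    ≡⟨ ℕ.⌊n/2⌋+⌈n/2⌉≡n k ⟨
    ⌊ k /2⌋ + ⌈ k /2⌉                    ≤⟨ ℕ.+-monoˡ-≤ ⌈ k /2⌉ (ℕ.⌊n/2⌋≤⌈n/2⌉ k) ⟩
    ⌈ k /2⌉ + ⌈ k /2⌉                    ≤⟨ ℕ.+-mono-≤ half half ⟩
    2 ^ t + 2 ^ t                        ≡⟨ cong (2 ^ t +_) (ℕ.+-identityʳ (2 ^ t)) ⟨
    2 ^ suc t                            ≡⟨ cong (2 ^_) 1+t≡⌈log₂k⌉ ⟩
    2 ^ ⌈log₂ k ⌉                        ∎
    where
    open ℕ.≤-Reasoning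
    t = ⌈log₂ ⌈ k /2⌉ ⌉
    half : ⌈ k /2⌉ ≤ 2 ^ t
    half = rec (ℕ.⌈n/2⌉<n m)
    1+t≡⌈log₂k⌉ : suc t ≡ ⌈log₂ k ⌉
    1+t≡⌈log₂k⌉ = trans (cong suc (⌈log₂⌈n/2⌉⌉≡⌈log₂n⌉∸1 k))
                        (ℕ.m+[n∸m]≡n (⌈log₂⌉-mono-≤ {2} {k} (s≤s (s≤s z≤n))))

2^⌈log₂k⌉≤2*k : ∀ k → 1 ≤ k → 2 ^ ⌈log₂ k ⌉ ≤ 2 * k
2^⌈log₂k⌉≤2*k k 1≤k with ⌈log₂ k ⌉ in ⌈log₂k⌉≡
... | zero  = ℕ.≤-trans 1≤k (ℕ.m≤m+n k _)
... | suc t = ℕ.*-monoʳ-≤ 2 (ℕ.<⇒≤ (ℕ.≰⇒> k≰2^t))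
  where
  k≰2^t : ¬ k ≤ 2 ^ t
  k≰2^t k≤2^t = ℕ.<-irrefl refl (subst₂ _≤_ ⌈log₂k⌉≡ (⌈log₂2^n⌉≡n t) (⌈log₂⌉-mono-≤ k≤2^t))

take-+ : ∀ {A : Set} m k (xs : List A) → take (m + k) xs ≡ take m xs ++ take k (drop m xs)
take-+ zero    k xs       = refl
take-+ (suc m) k []       = sym (List.take-[] k)
take-+ (suc m) k (x ∷ xs) = cong (x ∷_) (take-+ m k xs)

∸-split : ∀ {c a e} → c ≤ a → a ≤ e → (a ∸ c) + (e ∸ a) ≡ e ∸ c
∸-split {c} {a} {e} c≤a a≤e = trans (sym (ℕ.+-∸-comm (e ∸ a) c≤a)) (cong (_∸ c) (ℕ.m+[n∸m]≡n a≤e))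

factorAt-isFactor : ∀ {A : Set} {n} (u : Vec A n) {a b c d} → c ≤ a → a ≤ suc b → b ≤ d →
                    IsFactor (factorAt u (a , b)) (factorAt u (c , d))
factorAt-isFactor u {a} {b} {c} {d} c≤a a≤1+b b≤d =
  take (a ∸ c) outer , take (d ∸ b) (drop (suc b ∸ a) inner) , (begin
    take (suc d ∸ c) outer
      ≡⟨ cong (λ k → take k outer) (∸-split c≤a (ℕ.≤-trans a≤1+b (s≤s b≤d))) ⟨
    take ((a ∸ c) + (suc d ∸ a)) outer
      ≡⟨ take-+ (a ∸ c) (suc d ∸ a) outer ⟩
    take (a ∸ c) outer ++ take (suc d ∸ a) (drop (a ∸ c) outer)
      ≡⟨ cong (λ zs → take (a ∸ c) outer ++ take (suc d ∸ a) zs) drop-outer ⟩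
    take (a ∸ c) outer ++ take (suc d ∸ a) inner
      ≡⟨ cong (λ k → take (a ∸ c) outer ++ take k inner) (∸-split a≤1+b (s≤s b≤d)) ⟨
    take (a ∸ c) outer ++ take ((suc b ∸ a) + (d ∸ b)) inner
      ≡⟨ cong (take (a ∸ c) outer ++_) (take-+ (suc b ∸ a) (d ∸ b) inner) ⟩
    take (a ∸ c) outer ++ (take (suc b ∸ a) inner ++ take (d ∸ b) (drop (suc b ∸ a) inner))
      ∎)
  where
  open ≡-Reasoning
  outer = drop c (toList u)
  inner = drop a (toList u)
  drop-outer : drop (a ∸ c) outer ≡ inner
  drop-outer = trans (List.drop-drop c (a ∸ c) (toList u)) (cong (λ k → drop k (toList u)) (ℕ.m+[n∸m]≡n c≤a))

window-isFactor : ∀ {A : Set} {n} (u : Vec A n) (j : Fin n) ℓ {a b} → toℕ j ∈ᵢ (a , b) → b < n →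
                  intervalLength (a , b) ≤ ℓ → IsFactor (factorAt u (a , b)) (sampledFactor u j ℓ)
window-isFactor {n = n} u j ℓ {a} {b} (a≤j , j≤b) b<n length≤ℓ =
  factorAt-isFactor u left (ℕ.m≤n⇒m≤1+n a≤b)
    (ℕ.⊓-glb right (ℕ.m+n≤o⇒m≤o∸n b (subst (_≤ n) (ℕ.+-comm 1 b) b<n)))
  where
  a≤b = ℕ.≤-trans a≤j j≤b
  1+b≤ℓ+a : suc b ≤ ℓ + a
  1+b≤ℓ+a = ℕ.≤-trans (ℕ.≤-reflexive (sym (ℕ.m∸n+n≡m (ℕ.m≤n⇒m≤1+n a≤b)))) (ℕ.+-monoˡ-≤ a length≤ℓ)
  left : toℕ j ∸ ℓ ≤ a
  left = ℕ.m≤n+o⇒m∸n≤o (toℕ j) ℓ (ℕ.≤-trans j≤b (ℕ.≤-trans (ℕ.n≤1+n b) 1+b≤ℓ+a))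
  right : b ≤ toℕ j + ℓ
  right = ℕ.≤-trans (ℕ.n≤1+n b)
            (ℕ.≤-trans 1+b≤ℓ+a (ℕ.≤-trans (ℕ.≤-reflexive (ℕ.+-comm ℓ a)) (ℕ.+-monoˡ-≤ ℓ a≤j)))

Hit : List Interval → ℕ → Pred ℕ 0ℓ
Hit S ℓ j = Any (λ s → intervalLength s ≤ ℓ × j ∈ᵢ s) S

Hit? : ∀ S ℓ → Decidable (Hit S ℓ)
Hit? S ℓ j = any? (λ s → (intervalLength s ℕ.≤? ℓ) ×-dec (j ∈ᵢ? s)) S

hit⇒isFactor : ∀ {A : Set} {n} (u : Vec A n) {S} → All (ValidIn n) S → ∀ {ℓ} j → Hit S ℓ (toℕ j) →
               Any (λ s → IsFactor (factorAt u s) (sampledFactor u j ℓ)) S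
hit⇒isFactor u ((_ , b<n) ∷ _)     j (here (fits , j∈s)) = here (window-isFactor u j _ j∈s b<n fits)
hit⇒isFactor u (_         ∷ valid) j (there hit)        = there (hit⇒isFactor u valid j hit)

hits : (n : ℕ) → List Interval → ℕ → ℕ
hits n S ℓ = count (λ (j : Fin n) → Hit? S ℓ (toℕ j)) (allFin n)

misses : (n : ℕ) → List Interval → ℕ → ℕ
misses n S ℓ = count (λ (j : Fin n) → ∁? (Hit? S ℓ) (toℕ j)) (allFin n)

hits+misses≡n : ∀ n S ℓ → hits n S ℓ + misses n S ℓ ≡ n
hits+misses≡n n S ℓ =
  trans (count+count-∁ (λ (j : Fin n) → Hit? S ℓ (toℕ j)) (allFin n)) (List.length-tabulate {n = n} (λ i → i))

hits≤n : ∀ n S ℓ → hits n S ℓ ≤ n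
hits≤n n S ℓ = subst (hits n S ℓ ≤_) (hits+misses≡n n S ℓ) (ℕ.m≤m+n _ _)

misses≡n∸hits : ∀ n S ℓ → misses n S ℓ ≡ n ∸ hits n S ℓ
misses≡n∸hits n S ℓ = trans (sym (ℕ.m+n∸m≡n (hits n S ℓ) _)) (cong (_∸ hits n S ℓ) (hits+misses≡n n S ℓ))

Miss : ∀ {n} → List Interval → (ls : List ℕ) → Pred (Vec (Fin n) (length ls)) 0ℓ
Miss S []       []ᵥ     = ⊤
Miss S (ℓ ∷ ls) (j ∷ ω) = ¬ Hit S ℓ (toℕ j) × Miss S ls ω

Miss? : ∀ {n} S ls → Decidable (Miss {n} S ls)
Miss? S []       []ᵥ     = yes tt
Miss? S (ℓ ∷ ls) (j ∷ ω) = ¬? (Hit? S ℓ (toℕ j)) ×-dec Miss? S ls ω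

¬Miss⇒success : ∀ {A : Set} {n} (u : Vec A n) {S} → All (ValidIn n) S → ∀ ls (ω : Vec (Fin n) (length ls)) →
  ¬ Miss S ls ω → Any (λ w → Any (λ s → IsFactor (factorAt u s) w) S) (zipWith (sampledFactor u) (toList ω) ls)
¬Miss⇒success u valid []       []ᵥ     ¬miss = ⊥-elim (¬miss tt)
¬Miss⇒success u {S} valid (ℓ ∷ ls) (j ∷ ω) ¬miss with Hit? S ℓ (toℕ j)
... | yes hit  = here (hit⇒isFactor u valid j hit)
... | no  ¬hit = there (¬Miss⇒success u valid ls ω (λ miss → ¬miss (¬hit , miss)))

outcomes : (n k : ℕ) → List (Vec (Fin n) k)
outcomes n zero    = [ []ᵥ ]
outcomes n (suc k) = cartesianProductWith _∷_ (allFin n) (outcomes n k)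

outcomes-unique : ∀ n k → Unique (outcomes n k)
outcomes-unique n zero    = [] ∷ []
outcomes-unique n (suc k) =
  Unique.cartesianProductWith⁺ _∷_ ∷-injective (Unique.allFin⁺ n) (outcomes-unique n k)
  where
  ∷-injective : ∀ {i j : Fin n} {v w : Vec (Fin n) k} → i ∷ v ≡ j ∷ w → i ≡ j × v ≡ w
  ∷-injective refl = refl , refl

length-outcomes : ∀ n k → length (outcomes n k) ≡ n ^ k
length-outcomes n zero    = refl
length-outcomes n (suc k) =
  trans (length-cartesianProductWith _∷_ (allFin n) (outcomes n k))
        (cong₂ _*_ (List.length-tabulate {n = n} (λ i → i)) (length-outcomes n k))

count-Miss : ∀ n S ls → count (Miss? S ls) (outcomes n (length ls)) ≡ product (map (misses n S) ls)
count-Miss n S []       = refl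
count-Miss n S (ℓ ∷ ls) =
  trans (count-cartesianProductWith (λ (j : Fin n) → ∁? (Hit? S ℓ) (toℕ j)) (Miss? S ls) (Miss? S (ℓ ∷ ls))
                                    _∷_ (λ miss → miss) _,_ (allFin n) (outcomes n (length ls)))
        (cong (misses n S ℓ *_) (count-Miss n S ls))

count-Miss≡∏[n∸hits] : ∀ n S ls →
  count (Miss? S ls) (outcomes n (length ls)) ≡ product (map (n ∸_) (map (hits n S) ls))
count-Miss≡∏[n∸hits] n S ls = begin
  count (Miss? S ls) (outcomes n (length ls))  ≡⟨ count-Miss n S ls ⟩
  product (map (misses n S) ls)                ≡⟨ cong product (List.map-cong (misses≡n∸hits n S) ls) ⟩
  product (map (λ ℓ → n ∸ hits n S ℓ) ls)      ≡⟨ cong product (List.map-∘ {g = n ∸_} {f = hits n S} ls) ⟩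
  product (map (n ∸_) (map (hits n S) ls))     ∎
  where open ≡-Reasoning

-- Hits summed over the draws

sum-mono : ∀ {A : Set} {F G : A → ℕ} → (∀ t → G t ≤ F t) → ∀ ts → sum (map G ts) ≤ sum (map F ts)
sum-mono G≤F []       = z≤n
sum-mono G≤F (t ∷ ts) = ℕ.+-mono-≤ (G≤F t) (sum-mono G≤F ts)

sum-mono-∈ : ∀ {A : Set} {F G : A → ℕ} {x t₀ ts} → (∀ t → G t ≤ F t) → t₀ ∈ ts → x + G t₀ ≤ F t₀ →
             x + sum (map G ts) ≤ sum (map F ts)
sum-mono-∈ {F = F} {G} {x} {ts = t ∷ ts} G≤F (here refl) bonus = begin
  x + (G t + sum (map G ts))  ≡⟨ ℕ.+-assoc x (G t) _ ⟨
  x + G t + sum (map G ts)    ≤⟨ ℕ.+-mono-≤ bonus (sum-mono G≤F ts) ⟩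
  F t + sum (map F ts)        ∎
  where open ℕ.≤-Reasoning
sum-mono-∈ {F = F} {G} {x} {ts = t ∷ ts} G≤F (there t₀∈ts) bonus = begin
  x + (G t + sum (map G ts))  ≡⟨ swap x (G t) _ ⟩
  G t + (x + sum (map G ts))  ≤⟨ ℕ.+-mono-≤ (G≤F t) (sum-mono-∈ G≤F t₀∈ts bonus) ⟩
  F t + sum (map F ts)        ∎
  where
  open ℕ.≤-Reasoning
  swap : ∀ x y z → x + (y + z) ≡ y + (x + z)
  swap = solve-∀

module _ {A : Set} (class : A → ℕ) (w : A → ℕ) where

  classSum : List A → ℕ → ℕ
  classSum S t = sum (map w (filter (λ a → class a ℕ.≟ t) S))

  classSum-∷ : ∀ a S t → classSum S t ≤ classSum (a ∷ S) t
  classSum-∷ a S t = by-cases (class a ℕ.≟ t)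
    where
    by-cases : Dec (class a ≡ t) → classSum S t ≤ classSum (a ∷ S) t
    by-cases (yes a∈t) = ℕ.≤-trans (ℕ.m≤n+m _ (w a))
      (ℕ.≤-reflexive (cong (sum ∘ map w) (sym (List.filter-accept (λ a → class a ℕ.≟ t) a∈t))))
    by-cases (no  a∉t) =
      ℕ.≤-reflexive (cong (sum ∘ map w) (sym (List.filter-reject (λ a → class a ℕ.≟ t) a∉t)))

  sum-by-class : ∀ (f : ℕ → ℕ) {ts} S → All (λ a → class a ∈ ts) S →
    sum (map (λ a → f (class a) * w a) S) ≤ sum (map (λ t → f t * classSum S t) ts)
  sum-by-class f      []      _          = z≤n
  sum-by-class f {ts} (a ∷ S) (a∈ ∷ S∈) = begin
    f (class a) * w a + sum (map (λ a → f (class a) * w a) S)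
      ≤⟨ ℕ.+-monoʳ-≤ (f (class a) * w a) (sum-by-class f S S∈) ⟩
    f (class a) * w a + sum (map (λ t → f t * classSum S t) ts)
      ≤⟨ sum-mono-∈ (λ t → ℕ.*-monoʳ-≤ (f t) (classSum-∷ a S t)) a∈ (ℕ.≤-reflexive bonus) ⟩
    sum (map (λ t → f t * classSum (a ∷ S) t) ts)
      ∎
    where
    open ℕ.≤-Reasoning
    c = class a
    bonus : f c * w a + f c * classSum S c ≡ f c * classSum (a ∷ S) c
    bonus = trans (sym (ℕ.*-distribˡ-+ (f c) (w a) (classSum S c)))
                  (cong (λ xs → f c * sum (map w xs)) (sym (List.filter-accept (λ a → class a ℕ.≟ c) refl)))

sum-map-replicate : ∀ (h : ℕ → ℕ) k x → sum (map h (replicate k x)) ≡ k * h x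
sum-map-replicate h zero    x = refl
sum-map-replicate h (suc k) x = cong (h x +_) (sum-map-replicate h k x)

sum-drawLengths : ∀ (h : ℕ → ℕ) T r →
  sum (map h (drawLengths T r)) ≡ sum (map (λ t → suc (r t) * h (2 ^ t)) (upTo (suc T)))
sum-drawLengths h T r = go (upTo (suc T))
  where
  open ≡-Reasoning
  draws : ℕ → List ℕ
  draws t = replicate (suc (r t)) (2 ^ t)
  go : ∀ ts → sum (map h (concat (map draws ts))) ≡ sum (map (λ t → suc (r t) * h (2 ^ t)) ts)
  go []       = refl
  go (t ∷ ts) = begin
    sum (map h (draws t ++ concat (map draws ts)))           ≡⟨ cong sum (List.map-++ h (draws t) _) ⟩
    sum (map h (draws t) ++ map h (concat (map draws ts)))   ≡⟨ sum-++ (map h (draws t)) _ ⟩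
    sum (map h (draws t)) + sum (map h (concat (map draws ts)))
      ≡⟨ cong₂ _+_ (sum-map-replicate h (suc (r t)) (2 ^ t)) (go ts) ⟩
    suc (r t) * h (2 ^ t) + sum (map (λ t → suc (r t) * h (2 ^ t)) ts) ∎

lengthClass : Interval → ℕ
lengthClass s = ⌈log₂ intervalLength s ⌉

classSum≤hits : ∀ {n S} → All (ValidIn n) S → AllPairs Disjoint S →
                ∀ t → classSum lengthClass intervalLength S t ≤ hits n S (2 ^ t)
classSum≤hits {n} {S} valid disjoint t = begin
  sum (map intervalLength Sₜ)
    ≤⟨ sum-length≤count-Covered Sₜ (All.filter⁺ inClass? valid) (AllPairs.filter⁺ inClass? disjoint) ⟩
  count (Covered? Sₜ) (upTo n)      ≤⟨ count-mono (Covered? Sₜ) (Hit? S (2 ^ t)) covered⇒hit (upTo n) ⟩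
  count (Hit? S (2 ^ t)) (upTo n)   ≡⟨ count-allFin (Hit? S (2 ^ t)) n ⟨
  hits n S (2 ^ t)                  ∎
  where
  open ℕ.≤-Reasoning
  inClass? = λ s → lengthClass s ℕ.≟ t
  Sₜ = filter inClass? S
  covered⇒hit : Covered Sₜ ⊆ Hit S (2 ^ t)
  covered⇒hit covered with find covered
  ... | s , s∈Sₜ , j∈s with ∈-filter⁻ inClass? {xs = S} s∈Sₜ
  ... | s∈S , class≡t =
    lose s∈S (subst (λ k → intervalLength s ≤ 2 ^ k) class≡t (k≤2^⌈log₂k⌉ (intervalLength s)) , j∈s)

weight≤sum-hits : ∀ {n} S L (r : ℕ → ℕ) → All (ValidIn n) S → AllPairs Disjoint S →
  All (λ s → intervalLength s ≤ L) S →
  sum (map (λ s → r (lengthClass s) * intervalLength s) S) ≤ sum (map (hits n S) (drawLengths (samplerT L) r))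
weight≤sum-hits {n} S L r valid disjoint short = begin
  sum (map (λ s → r (lengthClass s) * intervalLength s) S)
    ≤⟨ sum-by-class lengthClass intervalLength r S classes ⟩
  sum (map (λ t → r t * classSum lengthClass intervalLength S t) ts)
    ≤⟨ sum-mono (λ t → ℕ.*-mono-≤ (ℕ.n≤1+n (r t)) (classSum≤hits valid disjoint t)) ts ⟩
  sum (map (λ t → suc (r t) * hits n S (2 ^ t)) ts)
    ≡⟨ sum-drawLengths (hits n S) (samplerT L) r ⟨
  sum (map (hits n S) (drawLengths (samplerT L) r))
    ∎
  where
  open ℕ.≤-Reasoning
  ts = upTo (suc (samplerT L))
  classes = All.map (λ s≤L → ∈-upTo⁺ (s≤s (⌈log₂⌉-mono-≤ s≤L))) short

n*ln3≤sum-hits : ∀ {n N} S L (r : ℕ → ℕ) → 1 ≤ N → N ≤ length S → All (ValidIn n) S → AllPairs Disjoint S →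
  All (λ s → intervalLength s ≤ L) S → (∀ t → t ≤ samplerT L → IsCeil2ln3β/ℓ n N (2 ^ t) (r t)) →
  ∀ m → fromℕ n ℚ.* ln3Partial m ℚ.≤ fromℕ (sum (map (hits n S) (drawLengths (samplerT L) r)))
n*ln3≤sum-hits {n} {N} S L r 1≤N N≤|S| valid disjoint short ceil m =
  ℚ.≤-trans (averaging weight 1≤N N≤|S| (*-nonNeg (0≤fromℕ n) (0≤ln3Partial m))
                       (All.zipWith bound (valid , short)))
            (fromℕ-mono-≤ (weight≤sum-hits S L r valid disjoint short))
  where
  weight : Interval → ℕ
  weight s = r (lengthClass s) * intervalLength s
  bound : ∀ {s} → ValidIn n s × intervalLength s ≤ L → fromℕ n ℚ.* ln3Partial m ℚ.≤ fromℕ (N * weight s)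
  bound {s@(a , b)} ((a≤b , _) , s≤L) =
    halve {n} {N * weight s}
      (ℚ.≤-trans (proj₁ (proj₂ (ceil t (⌈log₂⌉-mono-≤ s≤L))) m) (fromℕ-mono-≤ rN2ᵗ≤2Nw))
    where
    t = lengthClass s
    rearrange : ∀ r N l → r * N * (2 * l) ≡ 2 * (N * (r * l))
    rearrange = solve-∀
    rN2ᵗ≤2Nw : r t * N * 2 ^ t ≤ 2 * (N * weight s)
    rN2ᵗ≤2Nw = ℕ.≤-trans
      (ℕ.*-monoʳ-≤ (r t * N) (2^⌈log₂k⌉≤2*k (intervalLength s) (ℕ.m<n⇒0<n∸m (s≤s a≤b))))
                         (ℕ.≤-reflexive (rearrange (r t) N (intervalLength s)))

valid⇒1≤n : ∀ {n N S} → 1 ≤ N → N ≤ length S → All (ValidIn n) S → 1 ≤ n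
valid⇒1≤n 1≤N N≤0 []              = ⊥-elim (ℕ.1+n≰n (ℕ.≤-trans 1≤N N≤0))
valid⇒1≤n _   _   ((_ , b<n) ∷ _) = ℕ.≤-trans (s≤s z≤n) b<n

2k≤3g : ∀ {g b k} → b + g ≡ k → 3 * b ≤ k → 2 * k ≤ 3 * g
2k≤3g {g} {b} refl 3b≤k = ℕ.+-cancelʳ-≤ (3 * b) (2 * (b + g)) (3 * g) (begin
  2 * (b + g) + 3 * b        ≤⟨ ℕ.+-monoʳ-≤ (2 * (b + g)) 3b≤k ⟩
  2 * (b + g) + (b + g)      ≡⟨ expand b g ⟩
  3 * g + 3 * b              ∎)
  where
  open ℕ.≤-Reasoning
  expand : ∀ b g → 2 * (b + g) + (b + g) ≡ 3 * g + 3 * b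
  expand = solve-∀

lemma17 : {A : Set} (n : ℕ) (u : Vec A n) (N L : ℕ) → 1 ≤ N →
    (S : List Interval) →
    All (ValidIn n) S →
    AllPairs Disjoint S →
    N ≤ length S →
    All (λ s → intervalLength s ≤ L) S →
    (r : ℕ → ℕ) →
    (∀ t → t ≤ samplerT L → IsCeil2ln3β/ℓ n N (2 ^ t) (r t)) →
    ProbAtLeast2/3 u S (samplerT L) r
lemma17 n u N L 1≤N S valid disjoint N≤|S| short r ceil =
  good , Unique.filter⁺ ¬Miss? (outcomes-unique n D)
       , All.map (¬Miss⇒success u valid ls _) (All.all-filter ¬Miss? (outcomes n D))
       , 2k≤3g {g = length good} misses+good≡n^D 3*misses≤n^D
  where
  ls = drawLengths (samplerT L) r
  D = length ls
  ¬Miss? = ∁? (Miss? S ls)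
  good = filter ¬Miss? (outcomes n D)
  misses+good≡n^D : count (Miss? S ls) (outcomes n D) + length good ≡ n ^ D
  misses+good≡n^D = trans (count+count-∁ (Miss? S ls) (outcomes n D)) (length-outcomes n D)
  3*misses≤n^D : 3 * count (Miss? S ls) (outcomes n D) ≤ n ^ D
  3*misses≤n^D = subst₂ (λ c k → 3 * c ≤ n ^ k)
    (sym (count-Miss≡∏[n∸hits] n S ls))
    (List.length-map (hits n S) ls)
    (3*∏[n∸h]≤n^length n (valid⇒1≤n 1≤N N≤|S| valid) (map (hits n S) ls)
                       (All.map⁺ (All.universal (hits≤n n S) ls))
                       (n*ln3≤sum-hits S L r 1≤N N≤|S| valid disjoint short ceil))
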